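{- Let $p \ge 5$ be prime, let $H$ be the subgroup of $\mathbb{Z}_p^*$ generated by $\{ -1, 6\}$, and let $d$ be the order of the coset $2H$ in the quotient group $\mathbb{Z}_p^*/H$. If there exist nonnegative integers $\alpha$ and $\beta$ with $d = 3\alpha + 4\beta$, then there is a factorisation of $K_p$ into $\frac{\alpha(p-1)}{2d}$ copies of $\mathrm{Cay}(\mathbb{Z}_p; \pm\{1, 2, 3\})$ and $\frac{\beta(p-1)}{2d}$ copies of $\mathrm{Cay}(\mathbb{Z}_p; \pm\{1, 2, 3, 4\})$.
   Context: $\mathbb{Z}_p^*$ is the multiplicative group of units modulo $p$. $\pm\{a_1,\dots,a_s\}$ denotes $\{\pm a_1,\dots,\pm a_s\}$. The Cayley graph $\mathrm{Cay}(\mathbb{Z}_p;S)$ has vertex set $\mathbb{Z}_p$, with $x$ adjacent to $x+t$ for each $t\in S$. A factorisation of a graph is a decomposition of its edge set into edge-disjoint spanning subgraphs. -}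

module Defs where

open import Data.Nat using (ℕ; zero; suc; _+_; _*_; _∸_; _^_; _≤_; _<_; NonZero)
open import Data.Nat.DivMod using (_%_)
open import Data.Fin using (Fin; toℕ)
open import Data.Sum using (_⊎_; inj₁; inj₂)
open import Data.Product using (Σ; ∃; _×_; _,_)
open import Data.List using (List; _∷_; [])
open import Data.List.Membership.Propositional using (_∈_)
open import Relation.Binary.PropositionalEquality using (_≡_)
open import Relation.Nullary using (¬_)
open import Function.Bundles using (_↔_; _⇔_; Inverse)

-- The residue of (-1)^e modulo p, represented by natural numbers: -1 ≡ p ∸ 1.
signPow : ℕ → ℕ → ℕ
signPow p zero    = 1
signPow p (suc e) = (p ∸ 1) * signPow p e

-- Membership (of the residue class of x) in the subgroup H = ⟨-1, 6⟩ of Z_p^*.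
-- Since Z_p^* is finite abelian, ⟨-1, 6⟩ = { (-1)^e 6^k : e, k ∈ ℕ }.
InH : (p : ℕ) → .{{NonZero p}} → ℕ → Set
InH p x = ∃ λ e → ∃ λ k → x % p ≡ (signPow p e * 6 ^ k) % p

IsOrderOf2H : (p : ℕ) → .{{NonZero p}} → ℕ → Set
IsOrderOf2H p d =
  (1 ≤ d) × InH p (2 ^ d) × (∀ j → 1 ≤ j → j < d → ¬ InH p (2 ^ j))

Graph : ℕ → Set₁
Graph p = Fin p → Fin p → Set

Cay : (p : ℕ) → .{{NonZero p}} → List ℕ → Graph p
Cay p S x y = ∃ λ s → s ∈ S ×
  (((toℕ x + s) % p ≡ toℕ y) ⊎ ((toℕ y + s) % p ≡ toℕ x))

_≅_ : {p : ℕ} → Graph p → Graph p → Set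
_≅_ {p} G G' = Σ (Fin p ↔ Fin p) λ σ →
  ∀ x y → G (Inverse.to σ x) (Inverse.to σ y) ⇔ G' x y

-- Edges of the complete graph K_p: pairs of distinct vertices.
IsFactorisationOfK : (p : ℕ) {I : Set} → (I → Graph p) → Set
IsFactorisationOfK p {I} G =
  (∀ i x y → G i x y → ¬ x ≡ y) ×
  (∀ x y → ¬ x ≡ y → ∃ λ i → G i x y) ×
  (∀ x y i j → G i x y → G j x y → i ≡ j)

[_,_]F : ∀ {p a b} → (Fin a → Graph p) → (Fin b → Graph p) → (Fin a ⊎ Fin b → Graph p)
[ F , G ]F (inj₁ i) = F i
[ F , G ]F (inj₂ j) = G j

module Submission where

open import Defs
open import Data.Nat as ℕ using (ℕ; zero; suc; NonZero; z≤n; s≤s)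
import Data.Nat.Properties as ℕ
import Data.Nat.DivMod as ℕ
import Data.Nat.Divisibility as ℕ
open import Data.Nat.Primality using (Prime; euclidsLemma; prime⇒nonTrivial; prime⇒irreducible)
import Data.Nat.Tactic.RingSolver as ℕSolver
open import Data.Integer as ℤ using (ℤ; +_; ∣_∣; _%ℕ_; _/ℕ_; 0ℤ; 1ℤ; -1ℤ)
import Data.Integer.Properties as ℤ
open import Data.Integer.DivMod using (n%ℕd<d; a≡a%ℕn+[a/ℕn]*n)
open import Data.Integer.Divisibility.Signed as Signed using (_∣_; divides)
open import Data.Integer.Tactic.RingSolver using (solve-∀)
open import Data.Fin as Fin using (Fin; toℕ; fromℕ<)
import Data.Fin.Properties as Fin
open import Data.Fin.Permutation using (↔⇒≡)
open import Data.List using (List; []; _∷_; upTo; applyUpTo; filter; length; lookup; cartesianProductWith)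
open import Data.List.Membership.Propositional using (_∈_; lose; find)
open import Data.List.Membership.Propositional.Properties
  using (∈-cartesianProductWith⁺; ∈-cartesianProductWith⁻; ∈-upTo⁺; ∈-filter⁺; ∈-filter⁻; ∈-lookup)
open import Data.List.Relation.Unary.All as All using (All)
open import Data.List.Relation.Unary.AllPairs using (_∷_)
open import Data.List.Relation.Unary.Any as Any using (Any; any?; here; there)
import Data.List.Relation.Unary.Any.Properties as Any
open import Data.List.Relation.Unary.Unique.Propositional using (Unique)
import Data.List.Relation.Unary.Unique.Propositional.Properties as Unique
import Data.List.Extrema.Nat as Extrema
open import Data.Product using (∃; ∃₂; _×_; _,_; proj₁; proj₂; map; map₁; uncurry)
open import Data.Product.Algebra using (×-distribʳ-⊎)
open import Data.Product.Function.NonDependent.Propositional using (_×-↔_)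
open import Data.Sum using (_⊎_; inj₁; inj₂; [_,_]′)
open import Data.Sum.Function.Propositional using (_⊎-↔_)
open import Function using (id; _$_)
open import Function.Bundles using (_↔_; _⇔_; mk↔ₛ′; mk⇔; Inverse)
import Function.Properties.Equivalence as ⇔
open import Function.Properties.Inverse using (↔-refl; ↔-sym; ↔-trans)
open import Level using (0ℓ)
open import Relation.Binary.Bundles using (Setoid)
import Relation.Binary.Reasoning.Setoid as SetoidReasoning
open import Relation.Nullary using (¬_; Dec; yes; no; contradiction)
open import Relation.Nullary.Decidable using (map′; _×-dec_)
open import Relation.Unary using (Decidable)
open import Relation.Binary.PropositionalEquality as ≡ using (_≡_; _≢_; refl; cong; cong₂)

-- Let H₂ = ⟨H, 2⟩. As 2H has order d in Z_p^*/H, each coset of H₂ is the disjoint union of the d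
-- cosets 2^l H z (0 ≤ l < d), where H z, the base coset, is the H-coset on which the least residue of
-- the H₂-coset is attained. Taking one n < p/2 from each pair ±n of base points gives N representatives
-- rep k, and every unit is uniquely ±2^l rep k with l < d; hence p - 1 = 2dN.
-- Split the levels 0, …, d-1 into α runs of length 3 followed by β runs of length 4. For a run starting
-- at level Y, multiplication by m = 2^(Y+1) rep k maps Cay(Z_p; ±{1,…,w}) onto Cay(Z_p; ±m{1,…,w}).
-- As 3·2 = 6 ∈ H, the differences m, 2m, 3m, 4m lie on the levels Y+1, Y+2, Y, Y+3, and multiplying by
-- 6 permutes the representatives up to sign; so these graphs, over all runs and all k, partition K_p.

-- Arithmetic modulo p

module Modulo (p : ℕ) .{{_ : NonZero p}} where

  open import Data.Integer using (_+_; _*_; -_; _-_; _^_)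

  infix 4 _≈_ _≉_
  record _≈_ (a b : ℤ) : Set where
    constructor mk≈
    field divides-difference : + p ∣ a - b

  _≉_ : ℤ → ℤ → Set
  a ≉ b = ¬ a ≈ b

  ≈-reflexive : ∀ {a b} → a ≡ b → a ≈ b
  ≈-reflexive {a} refl = mk≈ (divides 0ℤ (≡.trans (ℤ.+-inverseʳ a) (≡.sym (ℤ.*-zeroˡ (+ p)))))

  ≈-refl : ∀ {a} → a ≈ a
  ≈-refl = ≈-reflexive refl

  ≈-sym : ∀ {a b} → a ≈ b → b ≈ a
  ≈-sym {a} {b} (mk≈ h) = mk≈ (≡.subst (+ p ∣_) (flip a b) (Signed.∣m⇒∣-m h))
    where flip : ∀ a b → - (a - b) ≡ b - a
          flip = solve-∀

  ≈-trans : ∀ {a b c} → a ≈ b → b ≈ c → a ≈ c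
  ≈-trans {a} {b} {c} (mk≈ h) (mk≈ k) = mk≈ (≡.subst (+ p ∣_) (telescope a b c) (Signed.∣m∣n⇒∣m+n h k))
    where telescope : ∀ a b c → (a - b) + (b - c) ≡ a - c
          telescope = solve-∀

  ≈-setoid : Setoid _ _
  ≈-setoid = record { Carrier = ℤ ; _≈_ = _≈_
                    ; isEquivalence = record { refl = ≈-refl ; sym = ≈-sym ; trans = ≈-trans } }

  module ≈-Reasoning = SetoidReasoning ≈-setoid

  +-cong : ∀ {a b c d} → a ≈ b → c ≈ d → a + c ≈ b + d
  +-cong {a} {b} {c} {d} (mk≈ h) (mk≈ k) = mk≈ (≡.subst (+ p ∣_) (regroup a b c d) (Signed.∣m∣n⇒∣m+n h k))
    where regroup : ∀ a b c d → (a - b) + (c - d) ≡ (a + c) - (b + d)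
          regroup = solve-∀

  *-cong : ∀ {a b c d} → a ≈ b → c ≈ d → a * c ≈ b * d
  *-cong {a} {b} {c} {d} (mk≈ h) (mk≈ k) =
    mk≈ (≡.subst (+ p ∣_) (regroup a b c d) (Signed.∣m∣n⇒∣m+n (Signed.∣m⇒∣m*n c h) (Signed.∣n⇒∣m*n b k)))
    where regroup : ∀ a b c d → (a - b) * c + b * (c - d) ≡ a * c - b * d
          regroup = solve-∀

  -‿cong : ∀ {a b} → a ≈ b → - a ≈ - b
  -‿cong {a} {b} (mk≈ h) = mk≈ (≡.subst (+ p ∣_) (regroup a b) (Signed.∣m⇒∣-m h))
    where regroup : ∀ a b → - (a - b) ≡ (- a) - (- b)
          regroup = solve-∀

  *-congˡ : ∀ {a b} c → a ≈ b → c * a ≈ c * b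
  *-congˡ c = *-cong (≈-refl {c})

  *-congʳ : ∀ {a b} c → a ≈ b → a * c ≈ b * c
  *-congʳ c h = *-cong h (≈-refl {c})

  ^-congˡ : ∀ {a b} n → a ≈ b → a ^ n ≈ b ^ n
  ^-congˡ zero    h = ≈-refl
  ^-congˡ (suc n) h = *-cong h (^-congˡ n h)

  ^-div-mod : ∀ a {b} n .{{_ : NonZero n}} → a ^ n ≈ b → ∀ j → a ^ j ≈ b ^ (j ℕ./ n) * a ^ (j ℕ.% n)
  ^-div-mod a {b} n aⁿ≈b j = begin
    a ^ j                                 ≡⟨ cong (a ^_) (ℕ.m≡m%n+[m/n]*n j n) ⟩
    a ^ (j ℕ.% n ℕ.+ j ℕ./ n ℕ.* n)       ≡⟨ ℤ.^-distribˡ-+-* a (j ℕ.% n) _ ⟩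
    a ^ (j ℕ.% n) * a ^ (j ℕ./ n ℕ.* n)   ≡⟨ cong (λ e → a ^ (j ℕ.% n) * a ^ e) (ℕ.*-comm (j ℕ./ n) n) ⟩
    a ^ (j ℕ.% n) * a ^ (n ℕ.* (j ℕ./ n)) ≡⟨ cong (a ^ (j ℕ.% n) *_) (ℤ.^-*-assoc a n (j ℕ./ n)) ⟨
    a ^ (j ℕ.% n) * (a ^ n) ^ (j ℕ./ n)   ≈⟨ *-congˡ (a ^ (j ℕ.% n)) (^-congˡ (j ℕ./ n) aⁿ≈b) ⟩
    a ^ (j ℕ.% n) * b ^ (j ℕ./ n)         ≡⟨ ℤ.*-comm (a ^ (j ℕ.% n)) (b ^ (j ℕ./ n)) ⟩
    b ^ (j ℕ./ n) * a ^ (j ℕ.% n)         ∎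
    where open ≈-Reasoning

  ^-mod : ∀ a n .{{_ : NonZero n}} → a ^ n ≈ 1ℤ → ∀ j → a ^ j ≈ a ^ (j ℕ.% n)
  ^-mod a n aⁿ≈1 j = ≈-trans (^-div-mod a n aⁿ≈1 j)
    (≈-reflexive (≡.trans (cong (_* a ^ (j ℕ.% n)) (ℤ.^-zeroˡ (j ℕ./ n))) (ℤ.*-identityˡ (a ^ (j ℕ.% n)))))

  inverse-cancelˡ : ∀ h h′ x → h * h′ ≈ 1ℤ → h′ * (h * x) ≈ x
  inverse-cancelˡ h h′ x hh′≈1 = begin
    h′ * (h * x)   ≡⟨ regroup h h′ x ⟩
    h * h′ * x     ≈⟨ *-congʳ x hh′≈1 ⟩
    1ℤ * x         ≡⟨ ℤ.*-identityˡ x ⟩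
    x              ∎
    where
    open ≈-Reasoning
    regroup : ∀ h h′ x → h′ * (h * x) ≡ h * h′ * x
    regroup = solve-∀

  interchange : ∀ a b c d → a * b * (c * d) ≡ a * c * (b * d)
  interchange = solve-∀

  ^-distribʳ-* : ∀ a b n → (a * b) ^ n ≡ a ^ n * b ^ n
  ^-distribʳ-* a b zero    = refl
  ^-distribʳ-* a b (suc n) = ≡.trans (cong (a * b *_) (^-distribʳ-* a b n)) (interchange a b (a ^ n) (b ^ n))

  ^-*-inverse : ∀ {a b} n → a * b ≈ 1ℤ → a ^ n * b ^ n ≈ 1ℤ
  ^-*-inverse {a} {b} n ab≈1 = begin
    a ^ n * b ^ n  ≡⟨ ^-distribʳ-* a b n ⟨
    (a * b) ^ n    ≈⟨ ^-congˡ n ab≈1 ⟩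
    1ℤ ^ n         ≡⟨ ℤ.^-zeroˡ n ⟩
    1ℤ             ∎
    where open ≈-Reasoning

  sign : Fin 2 → ℤ
  sign σ = -1ℤ ^ toℕ σ

  sign-involutive : ∀ σ → sign σ * sign σ ≡ 1ℤ
  sign-involutive Fin.zero           = refl
  sign-involutive (Fin.suc Fin.zero) = refl

  sign-* : ∀ σ τ → ∃ λ υ → sign σ * sign τ ≡ sign υ
  sign-* Fin.zero           τ                  = τ , ℤ.*-identityˡ (sign τ)
  sign-* (Fin.suc Fin.zero) Fin.zero           = Fin.suc Fin.zero , refl
  sign-* (Fin.suc Fin.zero) (Fin.suc Fin.zero) = Fin.zero , refl

  sign-move : ∀ τ a b → a ≈ sign τ * b → sign τ * a ≈ b
  sign-move τ a b a≈ = begin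
    sign τ * a              ≈⟨ *-congˡ (sign τ) a≈ ⟩
    sign τ * (sign τ * b)   ≡⟨ ℤ.*-assoc (sign τ) (sign τ) b ⟨
    sign τ * sign τ * b     ≡⟨ cong (_* b) (sign-involutive τ) ⟩
    1ℤ * b                  ≡⟨ ℤ.*-identityˡ b ⟩
    b                       ∎
    where open ≈-Reasoning

  -≈0⇒≈ : ∀ {a b} → a - b ≈ 0ℤ → a ≈ b
  -≈0⇒≈ {a} {b} (mk≈ p∣a-b-0) = mk≈ (≡.subst (+ p ∣_) (ℤ.+-identityʳ (a - b)) p∣a-b-0)

  +-multiple : ∀ a k → a + k * + p ≈ a
  +-multiple a k = mk≈ (divides k (cancel a k (+ p)))
    where cancel : ∀ a k q → a + k * q - a ≡ k * q
          cancel = solve-∀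

  p≈0 : + p ≈ 0ℤ
  p≈0 = mk≈ (divides 1ℤ (≡.trans (ℤ.+-identityʳ (+ p)) (≡.sym (ℤ.*-identityˡ (+ p)))))

  residue : ℤ → ℕ
  residue a = a %ℕ p

  residue<p : ∀ a → residue a ℕ.< p
  residue<p a = n%ℕd<d a p

  residue-≈ : ∀ a → + residue a ≈ a
  residue-≈ a = ≈-sym (≡.subst (_≈ + residue a) (≡.sym (a≡a%ℕn+[a/ℕn]*n a p)) (+-multiple (+ residue a) (a /ℕ p)))

  private
    small-multiple : ∀ {k} → k ℕ.< p → p ℕ.∣ k → k ≡ 0
    small-multiple {k} k<p p∣k = ≡.trans (≡.sym (ℕ.m<n⇒m%n≡m k<p)) (ℕ.n∣m⇒m%n≡0 k p p∣k)

    ≈-small-injective-≤ : ∀ {m n} → m ℕ.< p → n ℕ.≤ m → + m ≈ + n → m ≡ n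
    ≈-small-injective-≤ {m} {n} m<p n≤m (mk≈ h) =
      ℕ.≤-antisym (ℕ.m∸n≡0⇒m≤n (small-multiple (ℕ.≤-<-trans (ℕ.m∸n≤m m n) m<p) p∣m∸n)) n≤m
      where
      p∣m∸n : p ℕ.∣ m ℕ.∸ n
      p∣m∸n = ≡.subst (λ z → p ℕ.∣ ∣ z ∣) (≡.trans (ℤ.m-n≡m⊖n m n) (ℤ.⊖-≥ n≤m)) (Signed.∣⇒∣ᵤ h)

  residue-small : ∀ {n} → n ℕ.< p → residue (+ n) ≡ n
  residue-small = ℕ.m<n⇒m%n≡m

  ≈-small-injective : ∀ {m n} → m ℕ.< p → n ℕ.< p → + m ≈ + n → m ≡ n
  ≈-small-injective {m} {n} m<p n<p h with ℕ.≤-total n m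
  ... | inj₁ n≤m = ≈-small-injective-≤ m<p n≤m h
  ... | inj₂ m≤n = ≡.sym (≈-small-injective-≤ n<p m≤n (≈-sym h))

  residue-cong : ∀ {a b} → a ≈ b → residue a ≡ residue b
  residue-cong {a} {b} h =
    ≈-small-injective (residue<p a) (residue<p b) (≈-trans (residue-≈ a) (≈-trans h (≈-sym (residue-≈ b))))

  residue-injective : ∀ {a b} → residue a ≡ residue b → a ≈ b
  residue-injective {a} {b} eq = ≈-trans (≈-sym (residue-≈ a)) (≡.subst (λ r → + r ≈ b) (≡.sym eq) (residue-≈ b))

  small≉0 : ∀ {n} → 0 ℕ.< n → n ℕ.< p → + n ≉ 0ℤ
  small≉0 {suc n} _ n<p h with ≈-small-injective n<p (ℕ.<-trans (s≤s z≤n) n<p) h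
  ... | ()

  module _ (prime : Prime p) where

    private
      ≈0⇒∣ : ∀ {a} → a ≈ 0ℤ → p ℕ.∣ ∣ a ∣
      ≈0⇒∣ {a} (mk≈ h) = Signed.∣⇒∣ᵤ (≡.subst (+ p ∣_) (ℤ.+-identityʳ a) h)

      ∣⇒≈0 : ∀ {a} → p ℕ.∣ ∣ a ∣ → a ≈ 0ℤ
      ∣⇒≈0 {a} h = mk≈ (≡.subst (+ p ∣_) (≡.sym (ℤ.+-identityʳ a)) (Signed.∣ᵤ⇒∣ h))

    *≈0⇒≈0⊎≈0 : ∀ {a b} → a * b ≈ 0ℤ → a ≈ 0ℤ ⊎ b ≈ 0ℤ
    *≈0⇒≈0⊎≈0 {a} {b} h with euclidsLemma ∣ a ∣ ∣ b ∣ prime (≡.subst (p ℕ.∣_) (ℤ.abs-* a b) (≈0⇒∣ h))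
    ... | inj₁ p∣a = inj₁ (∣⇒≈0 p∣a)
    ... | inj₂ p∣b = inj₂ (∣⇒≈0 p∣b)

    *-≉0 : ∀ {a b} → a ≉ 0ℤ → b ≉ 0ℤ → a * b ≉ 0ℤ
    *-≉0 a≉0 b≉0 h with *≈0⇒≈0⊎≈0 h
    ... | inj₁ a≈0 = a≉0 a≈0
    ... | inj₂ b≈0 = b≉0 b≈0

    1≉0 : 1ℤ ≉ 0ℤ
    1≉0 = small≉0 (s≤s z≤n) (ℕ.nonTrivial⇒n>1 p {{prime⇒nonTrivial prime}})

    -1≉0 : -1ℤ ≉ 0ℤ
    -1≉0 -1≈0 = 1≉0 (-‿cong -1≈0)

    ^-≉0 : ∀ {a} n → a ≉ 0ℤ → a ^ n ≉ 0ℤ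
    ^-≉0 zero    a≉0 = 1≉0
    ^-≉0 (suc n) a≉0 = *-≉0 a≉0 (^-≉0 n a≉0)

    sign≉0 : ∀ σ → sign σ ≉ 0ℤ
    sign≉0 σ = ^-≉0 (toℕ σ) -1≉0

    *-cancelˡ : ∀ {c a b} → c ≉ 0ℤ → c * a ≈ c * b → a ≈ b
    *-cancelˡ {c} {a} {b} c≉0 (mk≈ p∣ca-cb) = cancel (*≈0⇒≈0⊎≈0 (mk≈ (≡.subst (+ p ∣_) (factor c a b) p∣ca-cb)))
      where
      factor : ∀ c a b → c * a - c * b ≡ c * (a - b) - 0ℤ
      factor = solve-∀
      cancel : c ≈ 0ℤ ⊎ a - b ≈ 0ℤ → a ≈ b
      cancel (inj₁ c≈0)   = contradiction c≈0 c≉0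
      cancel (inj₂ a-b≈0) = -≈0⇒≈ a-b≈0

    ^-collision : ∀ {a} → a ≉ 0ℤ → ∀ i t → a ^ (i ℕ.+ suc t) ≈ a ^ i → a ^ suc t ≈ 1ℤ
    ^-collision {a} a≉0 i t aⁱ⁺ᵗ⁺¹≈aⁱ = *-cancelˡ {a ^ i} {a ^ suc t} {1ℤ} (^-≉0 i a≉0) aⁱ*aᵗ⁺¹≈aⁱ*1
      where
      aⁱ*aᵗ⁺¹≈aⁱ*1 : a ^ i * a ^ suc t ≈ a ^ i * 1ℤ
      aⁱ*aᵗ⁺¹≈aⁱ*1 = begin
        a ^ i * a ^ suc t  ≡⟨ ℤ.^-distribˡ-+-* a i (suc t) ⟨
        a ^ (i ℕ.+ suc t)  ≈⟨ aⁱ⁺ᵗ⁺¹≈aⁱ ⟩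
        a ^ i              ≡⟨ ℤ.*-identityʳ (a ^ i) ⟨
        a ^ i * 1ℤ         ∎
        where open ≈-Reasoning

    *-cancelʳ : ∀ {c a b} → c ≉ 0ℤ → a * c ≈ b * c → a ≈ b
    *-cancelʳ {c} {a} {b} c≉0 ac≈bc =
      *-cancelˡ {c} {a} {b} c≉0 (≈-trans (≈-reflexive (ℤ.*-comm c a)) (≈-trans ac≈bc (≈-reflexive (ℤ.*-comm b c))))

    *≈1⇒≉0ʳ : ∀ a b → a * b ≈ 1ℤ → b ≉ 0ℤ
    *≈1⇒≉0ʳ a b ab≈1 b≈0 = 1≉0 (≈-trans (≈-sym ab≈1) (≈-trans (*-congˡ a b≈0) (≈-reflexive (ℤ.*-zeroʳ a))))

    -- Opaque, so that type checking never evaluates the pigeonhole search.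
    opaque
      period : ∀ {a} → a ≉ 0ℤ → ∃ λ t → a ^ suc t ≈ 1ℤ
      period {a} a≉0 = fromCollision (Fin.pigeonhole (ℕ.n<1+n p) residueOfPower)
        where
        residueOfPower : Fin (suc p) → Fin p
        residueOfPower i = fromℕ< (residue<p (a ^ toℕ i))

        fromCollision : (∃₂ λ i j → i Fin.< j × residueOfPower i ≡ residueOfPower j) → ∃ λ t → a ^ suc t ≈ 1ℤ
        fromCollision (i , j , i<j , same-residue) = t , ^-collision a≉0 (toℕ i) t aⁱ⁺ᵗ⁺¹≈aⁱ
          where
          t : ℕ
          t = toℕ j ℕ.∸ suc (toℕ i)
          aʲ≈aⁱ : a ^ toℕ j ≈ a ^ toℕ i
          aʲ≈aⁱ = residue-injective (≡.trans (≡.sym (Fin.toℕ-fromℕ< (residue<p (a ^ toℕ j))))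
            (≡.trans (cong toℕ (≡.sym same-residue)) (Fin.toℕ-fromℕ< (residue<p (a ^ toℕ i)))))
          aⁱ⁺ᵗ⁺¹≈aⁱ : a ^ (toℕ i ℕ.+ suc t) ≈ a ^ toℕ i
          aⁱ⁺ᵗ⁺¹≈aⁱ = ≡.subst (λ n → a ^ n ≈ a ^ toℕ i) (≡.sym (≡.trans (ℕ.+-suc (toℕ i) t) (ℕ.m+[n∸m]≡n i<j))) aʲ≈aⁱ

    inverse : ∀ {a} → a ≉ 0ℤ → ∃ λ b → a * b ≈ 1ℤ
    inverse {a} a≉0 = map (a ^_) id (period a≉0)


-- The subgroups H = ⟨-1, 6⟩ and H₂ = ⟨H, 2⟩

module Subgroups (p : ℕ) .{{_ : NonZero p}} (prime : Prime p) (5≤p : 5 ℕ.≤ p) where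

  open import Data.Integer using (_+_; _*_; -_; _-_; _^_)
  open Modulo p

  2≉0 : + 2 ≉ 0ℤ
  2≉0 = small≉0 (s≤s z≤n) (ℕ.≤-trans (s≤s (s≤s (s≤s z≤n))) 5≤p)

  3≉0 : + 3 ≉ 0ℤ
  3≉0 = small≉0 (s≤s z≤n) (ℕ.≤-trans (s≤s (s≤s (s≤s (s≤s z≤n)))) 5≤p)

  4≉0 : + 4 ≉ 0ℤ
  4≉0 = small≉0 (s≤s z≤n) 5≤p

  6≉0 : + 6 ≉ 0ℤ
  6≉0 = *-≉0 prime {+ 2} {+ 3} 2≉0 3≉0

  hword : ℕ → ℕ → ℤ
  hword e k = -1ℤ ^ e * (+ 6) ^ k

  -- As Z_p^* is abelian, ⟨-1, 6⟩ consists of the products (-1)^e 6^k.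
  H : ℤ → Set
  H a = ∃₂ λ e k → a ≈ hword e k

  H-cong : ∀ {a b} → a ≈ b → H a → H b
  H-cong a≈b (e , k , a≈) = e , k , ≈-trans (≈-sym a≈b) a≈

  hword-* : ∀ e k e′ k′ → hword e k * hword e′ k′ ≡ hword (e ℕ.+ e′) (k ℕ.+ k′)
  hword-* e k e′ k′ = begin
    -1ℤ ^ e * (+ 6) ^ k * (-1ℤ ^ e′ * (+ 6) ^ k′)   ≡⟨ interchange (-1ℤ ^ e) ((+ 6) ^ k) (-1ℤ ^ e′) ((+ 6) ^ k′) ⟩
    -1ℤ ^ e * -1ℤ ^ e′ * ((+ 6) ^ k * (+ 6) ^ k′)   ≡⟨ cong₂ _*_ (ℤ.^-distribˡ-+-* -1ℤ e e′) (ℤ.^-distribˡ-+-* (+ 6) k k′) ⟨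
    -1ℤ ^ (e ℕ.+ e′) * (+ 6) ^ (k ℕ.+ k′)         ∎
    where open ≡.≡-Reasoning

  H-* : ∀ {a b} → H a → H b → H (a * b)
  H-* (e , k , a≈) (e′ , k′ , b≈) = e ℕ.+ e′ , k ℕ.+ k′ , ≈-trans (*-cong a≈ b≈) (≈-reflexive (hword-* e k e′ k′))

  H-1 : H 1ℤ
  H-1 = 0 , 0 , ≈-refl

  H-6 : H (+ 6)
  H-6 = 0 , 1 , ≈-refl

  H-sign : ∀ σ → H (sign σ)
  H-sign σ = toℕ σ , 0 , ≈-reflexive (≡.sym (ℤ.*-identityʳ (sign σ)))

  H-^ : ∀ {a} n → H a → H (a ^ n)
  H-^ zero    _  = H-1
  H-^ (suc n) ha = H-* ha (H-^ n ha)

  private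
    order6 : ∃ λ t → (+ 6) ^ suc t ≈ 1ℤ
    order6 = period prime 6≉0

  hword-inverse : ∀ e k → hword e k * hword e (proj₁ order6 ℕ.* k) ≈ 1ℤ
  hword-inverse e k = begin
    -1ℤ ^ e * (+ 6) ^ k * (-1ℤ ^ e * (+ 6) ^ (t ℕ.* k))  ≡⟨ cong (λ z → -1ℤ ^ e * (+ 6) ^ k * (-1ℤ ^ e * z)) (ℤ.^-*-assoc (+ 6) t k) ⟨
    -1ℤ ^ e * (+ 6) ^ k * (-1ℤ ^ e * ((+ 6) ^ t) ^ k)    ≡⟨ interchange (-1ℤ ^ e) ((+ 6) ^ k) (-1ℤ ^ e) (((+ 6) ^ t) ^ k) ⟩
    -1ℤ ^ e * -1ℤ ^ e * ((+ 6) ^ k * ((+ 6) ^ t) ^ k)    ≈⟨ *-cong (^-*-inverse e ≈-refl) (^-*-inverse k (proj₂ order6)) ⟩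
    1ℤ                                                    ∎
    where
    open ≈-Reasoning
    t = proj₁ order6

  H-inverse : ∀ {a} → H a → ∃ λ b → H b × a * b ≈ 1ℤ
  H-inverse {a} (e , k , a≈) = hword e t′ , (e , t′ , ≈-refl) , ≈-trans (*-congʳ (hword e t′) a≈) (hword-inverse e k)
    where t′ = proj₁ order6 ℕ.* k

  H-≉0 : ∀ {a} → H a → a ≉ 0ℤ
  H-≉0 {a} ha = unit (H-inverse ha)
    where
    unit : (∃ λ b → H b × a * b ≈ 1ℤ) → a ≉ 0ℤ
    unit (b , _ , ab≈1) = *≈1⇒≉0ʳ prime b a (≈-trans (≈-reflexive (ℤ.*-comm b a)) ab≈1)

  H-divide : ∀ {u a} b → H u → H a → a ≈ u * b → H b
  H-divide {u} {a} b hu ha a≈ub = divide (H-inverse hu)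
    where
    divide : (∃ λ u′ → H u′ × u * u′ ≈ 1ℤ) → H b
    divide (u′ , hu′ , uu′≈1) = H-cong (≈-trans (*-congˡ u′ a≈ub) (inverse-cancelˡ u u′ b uu′≈1)) (H-* hu′ ha)

  Hwords : List ℤ
  Hwords = cartesianProductWith hword (upTo 2) (upTo (suc (proj₁ order6)))

  Hwords⊆H : ∀ {h} → h ∈ Hwords → H h
  Hwords⊆H h∈ with ∈-cartesianProductWith⁻ hword (upTo 2) (upTo (suc (proj₁ order6))) h∈
  ... | e , k , _ , _ , refl = e , k , ≈-refl

  H-normalise : ∀ {a} → H a → ∃ λ h → h ∈ Hwords × a ≈ h
  H-normalise (e , k , a≈) =
    hword (e ℕ.% 2) (k ℕ.% suc t) ,
    ∈-cartesianProductWith⁺ hword (∈-upTo⁺ (ℕ.m%n<n e 2)) (∈-upTo⁺ (ℕ.m%n<n k (suc t))) ,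
    ≈-trans a≈ (*-cong (^-mod -1ℤ 2 ≈-refl e) (^-mod (+ 6) (suc t) (proj₂ order6) k))
    where t = proj₁ order6

  module Levels (d : ℕ) .{{_ : NonZero d}} (2ᵈ∈H : H ((+ 2) ^ d))
                 (minimal : ∀ j → j ℕ.< d → H ((+ 2) ^ j) → j ≡ 0) where

    H₂ : ℤ → Set
    H₂ a = ∃₂ λ h j → H h × a ≈ h * (+ 2) ^ j

    H⇒H₂ : ∀ {a} → H a → H₂ a
    H⇒H₂ {a} ha = a , 0 , ha , ≈-reflexive (≡.sym (ℤ.*-identityʳ a))

    H₂-2^ : ∀ j → H₂ ((+ 2) ^ j)
    H₂-2^ j = 1ℤ , j , H-1 , ≈-reflexive (≡.sym (ℤ.*-identityˡ ((+ 2) ^ j)))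

    H₂-* : ∀ {a b} → H₂ a → H₂ b → H₂ (a * b)
    H₂-* (h , j , hh , a≈) (h′ , j′ , hh′ , b≈) = h * h′ , j ℕ.+ j′ , H-* hh hh′ ,
      ≈-trans (*-cong a≈ b≈) (≈-reflexive (≡.trans (interchange h ((+ 2) ^ j) h′ ((+ 2) ^ j′))
        (cong (h * h′ *_) (≡.sym (ℤ.^-distribˡ-+-* (+ 2) j j′)))))

    private
      order2 : ∃ λ t → (+ 2) ^ suc t ≈ 1ℤ
      order2 = period prime 2≉0

    H₂-inverse : ∀ {a} → H₂ a → ∃ λ b → H₂ b × a * b ≈ 1ℤ
    H₂-inverse {a} (h , j , hh , a≈) = invert (H-inverse hh)
      where
      t = proj₁ order2
      invert : (∃ λ h′ → H h′ × h * h′ ≈ 1ℤ) → ∃ λ b → H₂ b × a * b ≈ 1ℤ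
      invert (h′ , hh′ , hh′≈1) = h′ * (+ 2) ^ (t ℕ.* j) , (h′ , t ℕ.* j , hh′ , ≈-refl) ,
        ≈-trans (*-congʳ (h′ * (+ 2) ^ (t ℕ.* j)) a≈) inverse-product
        where
        inverse-product : h * (+ 2) ^ j * (h′ * (+ 2) ^ (t ℕ.* j)) ≈ 1ℤ
        inverse-product = begin
          h * (+ 2) ^ j * (h′ * (+ 2) ^ (t ℕ.* j))    ≡⟨ cong (λ z → h * (+ 2) ^ j * (h′ * z)) (ℤ.^-*-assoc (+ 2) t j) ⟨
          h * (+ 2) ^ j * (h′ * ((+ 2) ^ t) ^ j)      ≡⟨ interchange h ((+ 2) ^ j) h′ (((+ 2) ^ t) ^ j) ⟩
          h * h′ * ((+ 2) ^ j * ((+ 2) ^ t) ^ j)      ≈⟨ *-cong hh′≈1 (^-*-inverse j (proj₂ order2)) ⟩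
          1ℤ                                           ∎
          where open ≈-Reasoning

    H₂-reduce : ∀ {a} → H₂ a → ∃₂ λ h j → H h × j ℕ.< d × a ≈ h * (+ 2) ^ j
    H₂-reduce {a} (h , j , hh , a≈) = reduce 2ᵈ∈H
      where
      reduce : H ((+ 2) ^ d) → ∃₂ λ h j → H h × j ℕ.< d × a ≈ h * (+ 2) ^ j
      reduce (e , k , 2ᵈ≈) = h * hword e k ^ (j ℕ./ d) , j ℕ.% d , H-* hh (H-^ (j ℕ./ d) (e , k , ≈-refl)) ,
        ℕ.m%n<n j d , ≈-trans a≈ (≈-trans (*-congˡ h (^-div-mod (+ 2) d 2ᵈ≈ j))
          (≈-reflexive (≡.sym (ℤ.*-assoc h (hword e k ^ (j ℕ./ d)) ((+ 2) ^ (j ℕ.% d))))))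

    h₂word : ℤ → ℕ → ℤ
    h₂word h j = h * (+ 2) ^ j

    H₂words : List ℤ
    H₂words = cartesianProductWith h₂word Hwords (upTo d)

    H₂words⊆H₂ : ∀ {g} → g ∈ H₂words → H₂ g
    H₂words⊆H₂ g∈ with ∈-cartesianProductWith⁻ h₂word Hwords (upTo d) g∈
    ... | h , j , h∈ , _ , refl = h , j , Hwords⊆H h∈ , ≈-refl

    H₂-normalise : ∀ {a} → H₂ a → ∃ λ g → g ∈ H₂words × a ≈ g
    H₂-normalise {a} ha = normalise (H₂-reduce ha)
      where
      normalise : (∃₂ λ h j → H h × j ℕ.< d × a ≈ h * (+ 2) ^ j) → ∃ λ g → g ∈ H₂words × a ≈ g
      normalise (h , j , hh , j<d , a≈) = normaliseH (H-normalise hh)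
        where
        normaliseH : (∃ λ h′ → h′ ∈ Hwords × h ≈ h′) → ∃ λ g → g ∈ H₂words × a ≈ g
        normaliseH (h′ , h′∈ , h≈h′) = h₂word h′ j , ∈-cartesianProductWith⁺ h₂word h′∈ (∈-upTo⁺ j<d) ,
          ≈-trans a≈ (*-congʳ ((+ 2) ^ j) h≈h′)

    minimiser : ℤ → ℤ
    minimiser x = Extrema.argmin (λ g → residue (g * x)) 1ℤ H₂words

    orbitMin : ℤ → ℕ
    orbitMin x = residue (minimiser x * x)

    minimiser-H₂ : ∀ x → H₂ (minimiser x)
    minimiser-H₂ x = Extrema.argmin-all (λ g → residue (g * x)) (H⇒H₂ H-1) (All.tabulate H₂words⊆H₂)

    orbitMin-≤ : ∀ x {g} → H₂ g → orbitMin x ℕ.≤ residue (g * x)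
    orbitMin-≤ x {g} hg = bound (H₂-normalise hg)
      where
      bound : (∃ λ g′ → g′ ∈ H₂words × g ≈ g′) → orbitMin x ℕ.≤ residue (g * x)
      bound (g′ , g′∈ , g≈g′) =
        ≡.subst (orbitMin x ℕ.≤_) (residue-cong {g′ * x} {g * x} (*-congʳ x (≈-sym g≈g′)))
          (All.lookup (Extrema.f[argmin]≤f[xs] {f = λ g → residue (g * x)} 1ℤ H₂words) g′∈)

    orbitMin-invariant : ∀ {g x y} → H₂ g → y ≈ g * x → orbitMin y ≡ orbitMin x
    orbitMin-invariant {g} {x} {y} hg y≈gx = invariant (H₂-inverse hg)
      where
      invariant : (∃ λ g′ → H₂ g′ × g * g′ ≈ 1ℤ) → orbitMin y ≡ orbitMin x
      invariant (g′ , hg′ , gg′≈1) = ℕ.≤-antisym y≤x x≤y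
        where
        x≤y : orbitMin x ℕ.≤ orbitMin y
        x≤y = ≡.subst (orbitMin x ℕ.≤_)
          (residue-cong {minimiser y * g * x} {minimiser y * y}
            (≈-trans (≈-reflexive (ℤ.*-assoc (minimiser y) g x)) (*-congˡ (minimiser y) (≈-sym y≈gx))))
          (orbitMin-≤ x (H₂-* (minimiser-H₂ y) hg))
        y≤x : orbitMin y ℕ.≤ orbitMin x
        y≤x = ≡.subst (orbitMin y ℕ.≤_)
          (residue-cong {minimiser x * g′ * y} {minimiser x * x}
            (≈-trans (*-congˡ (minimiser x * g′) y≈gx) (≈-trans (≈-reflexive (ℤ.*-assoc (minimiser x) g′ (g * x)))
              (*-congˡ (minimiser x) (inverse-cancelˡ g g′ x gg′≈1)))))
          (orbitMin-≤ y (H₂-* (minimiser-H₂ x) hg′))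

    record Base (x : ℤ) : Set where
      constructor base
      field attained-on-H : Any (λ h → residue (h * x) ≡ orbitMin x) Hwords

    Base? : Decidable Base
    Base? x = map′ base Base.attained-on-H (any? (λ h → residue (h * x) ℕ.≟ orbitMin x) Hwords)

    Base-intro : ∀ {h} x → H h → residue (h * x) ≡ orbitMin x → Base x
    Base-intro {h} x hh eq = intro (H-normalise hh)
      where
      intro : (∃ λ h′ → h′ ∈ Hwords × h ≈ h′) → Base x
      intro (h′ , h′∈ , h≈h′) = base $ lose h′∈ (≡.trans (residue-cong {h′ * x} {h * x} (*-congʳ x (≈-sym h≈h′))) eq)

    Base-elim : ∀ {x} → Base x → ∃ λ h → H h × residue (h * x) ≡ orbitMin x
    Base-elim {x} (base attained) = elim (find attained)
      where
      elim : (∃ λ h → h ∈ Hwords × residue (h * x) ≡ orbitMin x) → ∃ λ h → H h × residue (h * x) ≡ orbitMin x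
      elim (h , h∈ , eq) = h , Hwords⊆H h∈ , eq

    Base-H : ∀ {h x y} → H h → y ≈ h * x → Base x → Base y
    Base-H {h} {x} {y} hh y≈hx bx = transfer (Base-elim bx) (H-inverse hh)
      where
      transfer : (∃ λ a → H a × residue (a * x) ≡ orbitMin x) → (∃ λ h′ → H h′ × h * h′ ≈ 1ℤ) → Base y
      transfer (a , ha , eq) (h′ , hh′ , hh′≈1) = Base-intro y (H-* ha hh′) (begin
        residue (a * h′ * y)  ≡⟨ residue-cong {a * h′ * y} {a * x} ah′y≈ax ⟩
        residue (a * x)       ≡⟨ eq ⟩
        orbitMin x            ≡⟨ orbitMin-invariant (H⇒H₂ hh) y≈hx ⟨
        orbitMin y            ∎)
        where
        open ≡.≡-Reasoning
        ah′y≈ax : a * h′ * y ≈ a * x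
        ah′y≈ax = ≈-trans (*-congˡ (a * h′) y≈hx)
          (≈-trans (≈-reflexive (ℤ.*-assoc a h′ (h * x))) (*-congˡ a (inverse-cancelˡ h h′ x hh′≈1)))

    Base-minimiser : ∀ {x h} j → H h → minimiser x ≈ h * (+ 2) ^ j → Base ((+ 2) ^ j * x)
    Base-minimiser {x} {h} j hh m≈ = Base-intro ((+ 2) ^ j * x) hh (begin
      residue (h * ((+ 2) ^ j * x))    ≡⟨ residue-cong {h * ((+ 2) ^ j * x)} {minimiser x * x}
                                            (≈-trans (≈-reflexive (≡.sym (ℤ.*-assoc h ((+ 2) ^ j) x))) (*-congʳ x (≈-sym m≈))) ⟩
      orbitMin x                       ≡⟨ orbitMin-invariant (H₂-2^ j) ≈-refl ⟨
      orbitMin ((+ 2) ^ j * x)         ∎)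
      where open ≡.≡-Reasoning

    decompose : ∀ {x} → x ≉ 0ℤ → ∃ λ l → l ℕ.< d × ∃ λ z → Base z × z ≉ 0ℤ × x ≈ (+ 2) ^ l * z
    decompose {x} x≉0 = fromReduced (H₂-reduce (minimiser-H₂ x))
      where
      fromReduced : (∃₂ λ h j → H h × j ℕ.< d × minimiser x ≈ h * (+ 2) ^ j) →
                    ∃ λ l → l ℕ.< d × ∃ λ z → Base z × z ≉ 0ℤ × x ≈ (+ 2) ^ l * z
      fromReduced (h , zero , hh , _ , m≈) =
        0 , ℕ.>-nonZero⁻¹ d , x , ≡.subst Base (ℤ.*-identityˡ x) (Base-minimiser 0 hh m≈) , x≉0 , ≈-reflexive (≡.sym (ℤ.*-identityˡ x))
      fromReduced (h , suc j , hh , j<d , m≈) = unshift (H-inverse 2ᵈ∈H)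
        where
        unshift : (∃ λ b → H b × (+ 2) ^ d * b ≈ 1ℤ) → ∃ λ l → l ℕ.< d × ∃ λ z → Base z × z ≉ 0ℤ × x ≈ (+ 2) ^ l * z
        unshift (b , hb , 2ᵈb≈1) =
          l , ℕ.∸-monoʳ-< (s≤s z≤n) (ℕ.<⇒≤ j<d) , b * ((+ 2) ^ suc j * x) , Base-H hb ≈-refl (Base-minimiser (suc j) hh m≈) ,
          *-≉0 prime (*≈1⇒≉0ʳ prime ((+ 2) ^ d) b 2ᵈb≈1) (*-≉0 prime (^-≉0 prime (suc j) 2≉0) x≉0) , ≈-sym (begin
            (+ 2) ^ l * (b * ((+ 2) ^ suc j * x))      ≡⟨ regroup ((+ 2) ^ l) b ((+ 2) ^ suc j) x ⟩
            (+ 2) ^ l * (+ 2) ^ suc j * b * x          ≡⟨ cong (λ n → n * b * x) 2ˡ2ʲ≡2ᵈ ⟩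
            (+ 2) ^ d * b * x                          ≈⟨ *-congʳ x 2ᵈb≈1 ⟩
            1ℤ * x                                     ≡⟨ ℤ.*-identityˡ x ⟩
            x                                          ∎)
          where
          open ≈-Reasoning
          l = d ℕ.∸ suc j
          2ˡ2ʲ≡2ᵈ : (+ 2) ^ l * (+ 2) ^ suc j ≡ (+ 2) ^ d
          2ˡ2ʲ≡2ᵈ = ≡.trans (≡.sym (ℤ.^-distribˡ-+-* (+ 2) l (suc j))) (cong ((+ 2) ^_) (ℕ.m∸n+n≡m (ℕ.<⇒≤ j<d)))
          regroup : ∀ a b c x → a * (b * (c * x)) ≡ a * c * b * x
          regroup = solve-∀

    Base-same-coset : ∀ {z z′ u} δ → Base z → Base z′ → z ≉ 0ℤ → H u → z′ ≈ u * (+ 2) ^ δ * z → H ((+ 2) ^ δ)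
    Base-same-coset {z} {z′} {u} δ bz bz′ z≉0 hu z′≈ = compare (Base-elim bz) (Base-elim bz′)
      where
      compare : (∃ λ a → H a × residue (a * z) ≡ orbitMin z) → (∃ λ a′ → H a′ × residue (a′ * z′) ≡ orbitMin z′) →
                H ((+ 2) ^ δ)
      compare (a , ha , az≡) (a′ , ha′ , a′z′≡) = H-divide ((+ 2) ^ δ) (H-* ha′ hu) ha a≈
        where
        az≈a′z′ : a * z ≈ a′ * z′
        az≈a′z′ = residue-injective {a * z} {a′ * z′} (≡.trans az≡ (≡.trans
                    (≡.sym (orbitMin-invariant (H₂-* (H⇒H₂ hu) (H₂-2^ δ)) z′≈)) (≡.sym a′z′≡)))
        a≈ : a ≈ a′ * u * (+ 2) ^ δ
        a≈ = *-cancelʳ prime {z} {a} {a′ * u * (+ 2) ^ δ} z≉0 (≈-trans az≈a′z′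
               (≈-trans (*-congˡ a′ z′≈) (≈-reflexive (regroup a′ u ((+ 2) ^ δ) z))))
          where regroup : ∀ a h e z → a * (h * e * z) ≡ a * h * e * z
                regroup = solve-∀

    private
      level-unique-≤ : ∀ {z z′ h} l l′ → l ℕ.< d → l′ ℕ.≤ l → Base z → Base z′ → z ≉ 0ℤ → H h →
                       (+ 2) ^ l * z ≈ h * ((+ 2) ^ l′ * z′) → l ≡ l′
      level-unique-≤ {z} {z′} {h} l l′ l<d l′≤l bz bz′ z≉0 hh eq = conclude (H-inverse hh)
        where
        δ = l ℕ.∸ l′
        l′+δ≡l : l′ ℕ.+ δ ≡ l
        l′+δ≡l = ℕ.m+[n∸m]≡n l′≤l
        2ᵟz≈hz′ : (+ 2) ^ δ * z ≈ h * z′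
        2ᵟz≈hz′ = *-cancelˡ prime {(+ 2) ^ l′} {(+ 2) ^ δ * z} {h * z′} (^-≉0 prime l′ 2≉0) (begin
          (+ 2) ^ l′ * ((+ 2) ^ δ * z)    ≡⟨ ℤ.*-assoc ((+ 2) ^ l′) ((+ 2) ^ δ) z ⟨
          (+ 2) ^ l′ * (+ 2) ^ δ * z      ≡⟨ cong (_* z) (≡.trans (≡.sym (ℤ.^-distribˡ-+-* (+ 2) l′ δ)) (cong ((+ 2) ^_) l′+δ≡l)) ⟩
          (+ 2) ^ l * z                   ≈⟨ eq ⟩
          h * ((+ 2) ^ l′ * z′)           ≡⟨ swap h ((+ 2) ^ l′) z′ ⟩
          (+ 2) ^ l′ * (h * z′)           ∎)
          where
          open ≈-Reasoning
          swap : ∀ h e z → h * (e * z) ≡ e * (h * z)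
          swap = solve-∀
        conclude : (∃ λ h′ → H h′ × h * h′ ≈ 1ℤ) → l ≡ l′
        conclude (h′ , hh′ , hh′≈1) = ≡.trans (≡.sym l′+δ≡l) (≡.trans (cong (l′ ℕ.+_) δ≡0) (ℕ.+-identityʳ l′))
          where
          z′≈ : z′ ≈ h′ * (+ 2) ^ δ * z
          z′≈ = ≈-sym (≈-trans (≈-reflexive (ℤ.*-assoc h′ ((+ 2) ^ δ) z))
                  (≈-trans (*-congˡ h′ 2ᵟz≈hz′) (inverse-cancelˡ h h′ z′ hh′≈1)))
          δ≡0 : δ ≡ 0
          δ≡0 = minimal δ (ℕ.≤-<-trans (ℕ.m∸n≤m l l′) l<d) (Base-same-coset δ bz bz′ z≉0 hh′ z′≈)

    level-unique : ∀ {z z′ h} l l′ → l ℕ.< d → l′ ℕ.< d → Base z → Base z′ → z ≉ 0ℤ → z′ ≉ 0ℤ → H h →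
                   (+ 2) ^ l * z ≈ h * ((+ 2) ^ l′ * z′) → l ≡ l′
    level-unique {z} {z′} {h} l l′ l<d l′<d bz bz′ z≉0 z′≉0 hh eq with ℕ.≤-total l′ l
    ... | inj₁ l′≤l = level-unique-≤ l l′ l<d l′≤l bz bz′ z≉0 hh eq
    ... | inj₂ l≤l′ = ≡.sym (flipped (H-inverse hh))
      where
      flipped : (∃ λ h′ → H h′ × h * h′ ≈ 1ℤ) → l′ ≡ l
      flipped (h′ , hh′ , hh′≈1) = level-unique-≤ l′ l l′<d l≤l′ bz′ bz z′≉0 hh′
        (≈-sym (≈-trans (*-congˡ h′ eq) (inverse-cancelˡ h h′ ((+ 2) ^ l′ * z′) hh′≈1)))


-- Representatives of the base points, and p - 1 = 2dN

lookup-injective : ∀ {A : Set} {xs : List A} → Unique xs → ∀ i j → lookup xs i ≡ lookup xs j → i ≡ j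
lookup-injective (_   ∷ _) Fin.zero    Fin.zero    _  = refl
lookup-injective (x∉ ∷ _) Fin.zero    (Fin.suc j) eq = contradiction eq (All.lookup x∉ (∈-lookup j))
lookup-injective (x∉ ∷ _) (Fin.suc i) Fin.zero    eq = contradiction (≡.sym eq) (All.lookup x∉ (∈-lookup i))
lookup-injective (_   ∷ u) (Fin.suc i) (Fin.suc j) eq = cong Fin.suc (lookup-injective u i j eq)

module Representatives (p : ℕ) .{{_ : NonZero p}} (prime : Prime p) (5≤p : 5 ℕ.≤ p)
                       (d : ℕ) .{{_ : NonZero d}} (2ᵈ∈H : Subgroups.H p prime 5≤p ((+ 2) ℤ.^ d))
                       (minimal : ∀ j → j ℕ.< d → Subgroups.H p prime 5≤p ((+ 2) ℤ.^ j) → j ≡ 0) where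

  open import Data.Integer using (_+_; _*_; -_; _-_; _^_)
  open Modulo p
  open Subgroups p prime 5≤p
  open Levels d 2ᵈ∈H minimal

  double≢p : ∀ r → r ℕ.+ r ≢ p
  double≢p r r+r≡p = [ (λ ()) , 2≢p ]′ (prime⇒irreducible prime 2∣p)
    where
    2∣p : 2 ℕ.∣ p
    2∣p = ℕ.divides r (≡.trans (≡.sym r+r≡p) (≡.trans (cong (r ℕ.+_) (≡.sym (ℕ.+-identityʳ r))) (ℕ.*-comm 2 r)))
    2≢p : 2 ≢ p
    2≢p 2≡p = contradiction (≡.subst (5 ℕ.≤_) (≡.sym 2≡p) 5≤p) λ { (s≤s (s≤s ())) }

  -- n < p / 2 singles out one of the residues ±n.
  IsRep : ℕ → Set
  IsRep n = 0 ℕ.< n × n ℕ.+ n ℕ.< p × Base (+ n)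

  isRep? : Decidable IsRep
  isRep? n = (0 ℕ.<? n) ×-dec (n ℕ.+ n ℕ.<? p) ×-dec Base? (+ n)

  reps : List ℕ
  reps = filter isRep? (upTo p)

  N : ℕ
  N = length reps

  rep : Fin N → ℕ
  rep = lookup reps

  rep-isRep : ∀ k → IsRep (rep k)
  rep-isRep k = proj₂ (∈-filter⁻ isRep? {xs = upTo p} (∈-lookup k))

  rep-complete : ∀ {n} → IsRep n → ∃ λ k → rep k ≡ n
  rep-complete {n} isRep = Any.index n∈reps , ≡.sym (Any.lookup-index n∈reps)
    where
    n∈reps : n ∈ reps
    n∈reps = ∈-filter⁺ isRep? (∈-upTo⁺ (ℕ.≤-<-trans (ℕ.m≤m+n n n) (proj₁ (proj₂ isRep)))) isRep

  rep-injective : ∀ k k′ → rep k ≡ rep k′ → k ≡ k′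
  rep-injective = lookup-injective (Unique.filter⁺ isRep? (Unique.upTo⁺ p))

  rep<p : ∀ k → rep k ℕ.< p
  rep<p k = ℕ.≤-<-trans (ℕ.m≤m+n (rep k) (rep k)) (proj₁ (proj₂ (rep-isRep k)))

  rep≉0 : ∀ k → + rep k ≉ 0ℤ
  rep≉0 k = small≉0 (proj₁ (rep-isRep k)) (rep<p k)

  Base-rep : ∀ k → Base (+ rep k)
  Base-rep k = proj₂ (proj₂ (rep-isRep k))

  sign-represent : ∀ σ {z} n → IsRep n → + n ≈ sign σ * z → ∃₂ λ σ k → z ≈ sign σ * + rep k
  sign-represent σ {z} n isRep n≈ = conclude (rep-complete isRep)
    where
    conclude : (∃ λ k → rep k ≡ n) → ∃₂ λ σ k → z ≈ sign σ * + rep k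
    conclude (k , rep≡n) = σ , k , ≈-sym (≈-trans (≈-reflexive (cong (λ m → sign σ * + m) rep≡n)) (sign-move σ (+ n) z n≈))

  Base⇒±rep : ∀ {z} → Base z → z ≉ 0ℤ → ∃₂ λ σ k → z ≈ sign σ * + rep k
  Base⇒±rep {z} bz z≉0 = byHalf (residue z ℕ.+ residue z ℕ.<? p)
    where
    byHalf : Dec (residue z ℕ.+ residue z ℕ.< p) → ∃₂ λ σ k → z ≈ sign σ * + rep k
    byHalf (yes r+r<p) = sign-represent Fin.zero r (0<r , r+r<p , Base-H H-1 r≈z bz) r≈z
      where
      r = residue z
      r≈z : + r ≈ 1ℤ * z
      r≈z = ≈-trans (residue-≈ z) (≈-reflexive (≡.sym (ℤ.*-identityˡ z)))
      0<r : 0 ℕ.< r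
      0<r = ℕ.n≢0⇒n>0 (λ r≡0 → z≉0 (≈-trans (≈-sym (residue-≈ z)) (≈-reflexive (cong +_ r≡0))))
    byHalf (no r+r≮p) = sign-represent (Fin.suc Fin.zero) n (0<n , n+n<p , Base-H (H-sign (Fin.suc Fin.zero)) n≈-z bz) n≈-z
      where
      r = residue z
      n = p ℕ.∸ r
      n+r≡p : n ℕ.+ r ≡ p
      n+r≡p = ℕ.m∸n+n≡m (ℕ.<⇒≤ (residue<p z))
      n<r : n ℕ.< r
      n<r = ℕ.+-cancelʳ-< r n r (≡.subst (ℕ._< r ℕ.+ r) (≡.sym n+r≡p)
              (ℕ.≤∧≢⇒< (ℕ.≮⇒≥ r+r≮p) (λ p≡r+r → double≢p r (≡.sym p≡r+r))))
      0<n : 0 ℕ.< n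
      0<n = ℕ.m<n⇒0<n∸m (residue<p z)
      n+n<p : n ℕ.+ n ℕ.< p
      n+n<p = ≡.subst (n ℕ.+ n ℕ.<_) n+r≡p (ℕ.+-monoʳ-< n n<r)
      n≈-z : + n ≈ -1ℤ * z
      n≈-z = begin
        + n            ≡⟨ ≡.trans (ℤ.m-n≡m⊖n p r) (ℤ.⊖-≥ (ℕ.<⇒≤ (residue<p z))) ⟨
        + p - + r      ≈⟨ +-cong p≈0 (-‿cong (residue-≈ z)) ⟩
        0ℤ - z         ≡⟨ ℤ.+-identityˡ (- z) ⟩
        - z            ≡⟨ ℤ.-1*i≡-i z ⟨
        -1ℤ * z        ∎
        where open ≈-Reasoning

  private
    halves-sum : ∀ {a b} → a ℕ.+ a ℕ.< p → b ℕ.+ b ℕ.< p → a ℕ.+ b ℕ.< p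
    halves-sum {a} {b} a+a<p b+b<p with ℕ.≤-total a b
    ... | inj₁ a≤b = ℕ.≤-<-trans (ℕ.+-monoˡ-≤ b a≤b) b+b<p
    ... | inj₂ b≤a = ℕ.≤-<-trans (ℕ.+-monoʳ-≤ a b≤a) a+a<p

    rep≉-rep : ∀ k k′ → 1ℤ * + rep k ≉ -1ℤ * + rep k′
    rep≉-rep k k′ eq = small≉0 (ℕ.<-≤-trans (proj₁ (rep-isRep k)) (ℕ.m≤m+n (rep k) (rep k′)))
      (halves-sum {rep k} {rep k′} (proj₁ (proj₂ (rep-isRep k))) (proj₁ (proj₂ (rep-isRep k′)))) (begin
        + (rep k ℕ.+ rep k′)           ≡⟨ ℤ.pos-+ (rep k) (rep k′) ⟩
        + rep k + + rep k′             ≡⟨ cong (_+ + rep k′) (ℤ.*-identityˡ (+ rep k)) ⟨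
        1ℤ * + rep k + + rep k′        ≈⟨ +-cong eq (≈-refl {+ rep k′}) ⟩
        -1ℤ * + rep k′ + + rep k′      ≡⟨ cancel (+ rep k′) ⟩
        0ℤ                             ∎)
      where
      open ≈-Reasoning
      cancel : ∀ r → -1ℤ * r + r ≡ 0ℤ
      cancel = solve-∀

  ±rep-injective : ∀ σ σ′ k k′ → sign σ * + rep k ≈ sign σ′ * + rep k′ → σ ≡ σ′ × k ≡ k′
  ±rep-injective Fin.zero Fin.zero k k′ eq =
    refl , rep-injective k k′ (≈-small-injective (rep<p k) (rep<p k′)
      (≈-trans (≈-reflexive (≡.sym (ℤ.*-identityˡ (+ rep k)))) (≈-trans eq (≈-reflexive (ℤ.*-identityˡ (+ rep k′))))))
  ±rep-injective (Fin.suc Fin.zero) (Fin.suc Fin.zero) k k′ eq =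
    refl , rep-injective k k′ (≈-small-injective (rep<p k) (rep<p k′)
      (*-cancelˡ prime { -1ℤ} {+ rep k} {+ rep k′} (-1≉0 prime) eq))
  ±rep-injective Fin.zero (Fin.suc Fin.zero) k k′ eq = contradiction eq (rep≉-rep k k′)
  ±rep-injective (Fin.suc Fin.zero) Fin.zero k k′ eq = contradiction (≈-sym eq) (rep≉-rep k′ k)

  Code : Set
  Code = Fin 2 × Fin d × Fin N

  ⟦_⟧ : Code → ℤ
  ⟦ σ , l , k ⟧ = sign σ * ((+ 2) ^ toℕ l * + rep k)

  ⟦⟧≉0 : ∀ c → ⟦ c ⟧ ≉ 0ℤ
  ⟦⟧≉0 (σ , l , k) = *-≉0 prime {sign σ} {(+ 2) ^ toℕ l * + rep k} (sign≉0 prime σ)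
                       (*-≉0 prime {(+ 2) ^ toℕ l} {+ rep k} (^-≉0 prime {+ 2} (toℕ l) 2≉0) (rep≉0 k))

  -- Opaque for the same reason as period.
  opaque
    decode : ∀ {x} → x ≉ 0ℤ → ∃ λ c → x ≈ ⟦ c ⟧
    decode {x} x≉0 = atLevel (decompose x≉0)
      where
      atLevel : (∃ λ l → l ℕ.< d × ∃ λ z → Base z × z ≉ 0ℤ × x ≈ (+ 2) ^ l * z) → ∃ λ c → x ≈ ⟦ c ⟧
      atLevel (l , l<d , z , bz , z≉0 , x≈) = withSign (Base⇒±rep bz z≉0)
        where
        withSign : (∃₂ λ σ k → z ≈ sign σ * + rep k) → ∃ λ c → x ≈ ⟦ c ⟧
        withSign (σ , k , z≈) = (σ , fromℕ< l<d , k) , (begin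
          x                                              ≈⟨ x≈ ⟩
          (+ 2) ^ l * z                                  ≈⟨ *-congˡ ((+ 2) ^ l) z≈ ⟩
          (+ 2) ^ l * (sign σ * + rep k)                 ≡⟨ swap ((+ 2) ^ l) (sign σ) (+ rep k) ⟩
          sign σ * ((+ 2) ^ l * + rep k)                 ≡⟨ cong (λ n → sign σ * ((+ 2) ^ n * + rep k)) (Fin.toℕ-fromℕ< l<d) ⟨
          sign σ * ((+ 2) ^ toℕ (fromℕ< l<d) * + rep k)  ∎)
          where
          open ≈-Reasoning
          swap : ∀ a b c → a * (b * c) ≡ b * (a * c)
          swap = solve-∀

  private
    unsign : ∀ σ σ′ a b → sign σ * a ≈ sign σ′ * b → a ≈ sign σ * sign σ′ * b
    unsign σ σ′ a b eq = ≈-trans (≈-sym (sign-move σ (sign σ′ * b) a (≈-sym eq))) (≈-reflexive (≡.sym (ℤ.*-assoc (sign σ) (sign σ′) b)))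

    same-level⇒≡ : ∀ σ σ′ l k k′ → ⟦ σ , l , k ⟧ ≈ ⟦ σ′ , l , k′ ⟧ → σ ≡ σ′ × k ≡ k′
    same-level⇒≡ σ σ′ l k k′ eq = ±rep-injective σ σ′ k k′
      (*-cancelˡ prime {(+ 2) ^ toℕ l} {sign σ * + rep k} {sign σ′ * + rep k′} (^-≉0 prime {+ 2} (toℕ l) 2≉0)
        (≈-trans (≈-reflexive (swap ((+ 2) ^ toℕ l) (sign σ) (+ rep k)))
          (≈-trans eq (≈-reflexive (swap (sign σ′) ((+ 2) ^ toℕ l) (+ rep k′))))))
      where
      swap : ∀ a b c → a * (b * c) ≡ b * (a * c)
      swap = solve-∀

  ⟦⟧-injective : ∀ c c′ → ⟦ c ⟧ ≈ ⟦ c′ ⟧ → c ≡ c′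
  ⟦⟧-injective (σ , l , k) (σ′ , l′ , k′) eq = conclude (Fin.toℕ-injective same-level) eq
    where
    same-level : toℕ l ≡ toℕ l′
    same-level = level-unique (toℕ l) (toℕ l′) (Fin.toℕ<n l) (Fin.toℕ<n l′) (Base-rep k) (Base-rep k′)
                   (rep≉0 k) (rep≉0 k′) (H-* (H-sign σ) (H-sign σ′))
                   (unsign σ σ′ ((+ 2) ^ toℕ l * + rep k) ((+ 2) ^ toℕ l′ * + rep k′) eq)
    conclude : ∀ {m} → l ≡ m → ⟦ σ , l , k ⟧ ≈ ⟦ σ′ , m , k′ ⟧ → (σ , l , k) ≡ (σ′ , m , k′)
    conclude refl eq′ = uncurry (cong₂ (λ s c → s , l , c)) (same-level⇒≡ σ σ′ l k k′ eq′)

  private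
    unit<p : ∀ (i : Fin (p ℕ.∸ 1)) → suc (toℕ i) ℕ.< p
    unit<p i = ≡.subst (suc (toℕ i) ℕ.<_) (ℕ.suc-pred p) (s≤s (Fin.toℕ<n i))

    code : Fin (p ℕ.∸ 1) → Code
    code i = proj₁ (decode (small≉0 (s≤s z≤n) (unit<p i)))

    residue⟦⟧>0 : ∀ c → 0 ℕ.< residue ⟦ c ⟧
    residue⟦⟧>0 c = ℕ.n≢0⇒n>0 (λ r≡0 → ⟦⟧≉0 c (≈-trans (≈-sym (residue-≈ ⟦ c ⟧)) (≈-reflexive (cong +_ r≡0))))

    unit : Code → Fin (p ℕ.∸ 1)
    unit c = fromℕ< (ℕ.∸-monoˡ-< (residue<p ⟦ c ⟧) (residue⟦⟧>0 c))

    suc-unit : ∀ c → suc (toℕ (unit c)) ≡ residue ⟦ c ⟧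
    suc-unit c = ≡.trans (cong suc (Fin.toℕ-fromℕ< _)) (ℕ.suc-pred (residue ⟦ c ⟧) {{ℕ.>-nonZero (residue⟦⟧>0 c)}})

    code-unit : ∀ c → code (unit c) ≡ c
    code-unit c = ⟦⟧-injective (code (unit c)) c (≈-sym (≈-trans (≈-sym (residue-≈ ⟦ c ⟧))
      (≡.subst (λ n → + n ≈ ⟦ code (unit c) ⟧) (suc-unit c) (proj₂ (decode (small≉0 (s≤s z≤n) (unit<p (unit c))))))))

    unit-code : ∀ i → unit (code i) ≡ i
    unit-code i = Fin.toℕ-injective (ℕ.suc-injective (begin
      suc (toℕ (unit (code i)))    ≡⟨ suc-unit (code i) ⟩
      residue ⟦ code i ⟧           ≡⟨ residue-cong (≈-sym (proj₂ (decode (small≉0 (s≤s z≤n) (unit<p i))))) ⟩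
      residue (+ suc (toℕ i))      ≡⟨ residue-small (unit<p i) ⟩
      suc (toℕ i)                  ∎))
      where open ≡.≡-Reasoning

  units↔codes : Fin (p ℕ.∸ 1) ↔ Code
  units↔codes = mk↔ₛ′ code unit code-unit unit-code

  p∸1≡2dN : p ℕ.∸ 1 ≡ 2 ℕ.* (d ℕ.* N)
  p∸1≡2dN = ↔⇒≡ (↔-trans units↔codes (↔-sym (↔-trans Fin.*↔× (↔-refl ×-↔ Fin.*↔×))))


-- The factorisation

module ScaledCayley (p : ℕ) .{{_ : NonZero p}} (prime : Prime p) where

  open import Data.Integer using (_+_; _*_; -_; _-_; _^_)
  open Modulo p

  ScaledCay : ℤ → List ℕ → Graph p
  ScaledCay m S x y = ∃ λ s → s ∈ S × ∃ λ σ → + toℕ y - + toℕ x ≈ sign σ * (+ s * m)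

  private
    step⇒ : ∀ (x y : Fin p) s → (toℕ x ℕ.+ s) ℕ.% p ≡ toℕ y → + toℕ y - + toℕ x ≈ + s * 1ℤ
    step⇒ x y s eq = begin
      + toℕ y - + toℕ x                 ≈⟨ +-cong (≈-sym x+s≈y) (≈-refl { - (+ toℕ x)}) ⟩
      + (toℕ x ℕ.+ s) - + toℕ x         ≡⟨ cong (_- + toℕ x) (ℤ.pos-+ (toℕ x) s) ⟩
      + toℕ x + + s - + toℕ x           ≡⟨ cancel (+ toℕ x) (+ s) ⟩
      + s * 1ℤ                          ∎
      where
      open ≈-Reasoning
      x+s≈y : + (toℕ x ℕ.+ s) ≈ + toℕ y
      x+s≈y = residue-injective {+ (toℕ x ℕ.+ s)} {+ toℕ y} (≡.trans eq (≡.sym (residue-small (Fin.toℕ<n y))))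
      cancel : ∀ a b → a + b - a ≡ b * 1ℤ
      cancel = solve-∀

    step⇐ : ∀ (x y : Fin p) s → + toℕ y - + toℕ x ≈ + s * 1ℤ → (toℕ x ℕ.+ s) ℕ.% p ≡ toℕ y
    step⇐ x y s eq = ≡.trans (residue-cong {+ (toℕ x ℕ.+ s)} {+ toℕ y} (begin
      + (toℕ x ℕ.+ s)                   ≡⟨ ℤ.pos-+ (toℕ x) s ⟩
      + toℕ x + + s                     ≡⟨ cong (λ z → + toℕ x + z) (ℤ.*-identityʳ (+ s)) ⟨
      + toℕ x + + s * 1ℤ                ≈⟨ +-cong (≈-refl {+ toℕ x}) (≈-sym eq) ⟩
      + toℕ x + (+ toℕ y - + toℕ x)     ≡⟨ cancel (+ toℕ x) (+ toℕ y) ⟩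
      + toℕ y                           ∎)) (residue-small (Fin.toℕ<n y))
      where
      open ≈-Reasoning
      cancel : ∀ a b → a + (b - a) ≡ b
      cancel = solve-∀

    flip-difference : ∀ (x y : Fin p) c → + toℕ y - + toℕ x ≈ -1ℤ * c → + toℕ x - + toℕ y ≈ c
    flip-difference x y c eq =
      ≈-trans (≈-reflexive (negate (+ toℕ x) (+ toℕ y))) (≈-trans (-‿cong eq) (≈-reflexive (unnegate c)))
      where
      negate : ∀ a b → a - b ≡ - (b - a)
      negate = solve-∀
      unnegate : ∀ c → - (-1ℤ * c) ≡ c
      unnegate = solve-∀

    unflip-difference : ∀ (x y : Fin p) c → + toℕ x - + toℕ y ≈ c → + toℕ y - + toℕ x ≈ -1ℤ * c
    unflip-difference x y c eq =
      ≈-trans (≈-reflexive (negate (+ toℕ y) (+ toℕ x))) (≈-trans (-‿cong eq) (≈-reflexive (≡.sym (ℤ.-1*i≡-i c))))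
      where
      negate : ∀ a b → a - b ≡ - (b - a)
      negate = solve-∀

  Cay⇔ScaledCay1 : ∀ S x y → Cay p S x y ⇔ ScaledCay 1ℤ S x y
  Cay⇔ScaledCay1 S x y = mk⇔ forward backward
    where
    forward : Cay p S x y → ScaledCay 1ℤ S x y
    forward (s , s∈ , inj₁ e) = s , s∈ , Fin.zero , ≈-trans (step⇒ x y s e) (≈-reflexive (≡.sym (ℤ.*-identityˡ (+ s * 1ℤ))))
    forward (s , s∈ , inj₂ e) = s , s∈ , Fin.suc Fin.zero , unflip-difference x y (+ s * 1ℤ) (step⇒ y x s e)
    backward : ScaledCay 1ℤ S x y → Cay p S x y
    backward (s , s∈ , Fin.zero , e) = s , s∈ , inj₁ (step⇐ x y s (≈-trans e (≈-reflexive (ℤ.*-identityˡ (+ s * 1ℤ)))))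
    backward (s , s∈ , Fin.suc Fin.zero , e) = s , s∈ , inj₂ (step⇐ y x s (flip-difference x y (+ s * 1ℤ) e))

  private
    mul : ℤ → Fin p → Fin p
    mul c x = fromℕ< (residue<p (c * + toℕ x))

    toℕ-mul : ∀ c x → + toℕ (mul c x) ≈ c * + toℕ x
    toℕ-mul c x = ≈-trans (≈-reflexive (cong +_ (Fin.toℕ-fromℕ< (residue<p (c * + toℕ x))))) (residue-≈ (c * + toℕ x))

    mul-inverse : ∀ c c′ → c * c′ ≈ 1ℤ → ∀ x → mul c′ (mul c x) ≡ x
    mul-inverse c c′ cc′≈1 x = Fin.toℕ-injective (≈-small-injective (Fin.toℕ<n (mul c′ (mul c x))) (Fin.toℕ<n x)
      (≈-trans (toℕ-mul c′ (mul c x)) (≈-trans (*-congˡ c′ (toℕ-mul c x)) (inverse-cancelˡ c c′ (+ toℕ x) cc′≈1))))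

  scale-iso : ∀ {m} → m ≉ 0ℤ → ∀ S → ScaledCay m S ≅ Cay p S
  scale-iso {m} m≉0 S = iso (inverse prime m≉0)
    where
    iso : (∃ λ m′ → m * m′ ≈ 1ℤ) → ScaledCay m S ≅ Cay p S
    iso (m′ , mm′≈1) = mk↔ₛ′ (mul m) (mul m′) (mul-inverse m′ m (≈-trans (≈-reflexive (ℤ.*-comm m′ m)) mm′≈1)) (mul-inverse m m′ mm′≈1) ,
                       λ x y → ⇔.trans (rescale x y) (⇔.sym (Cay⇔ScaledCay1 S x y))
      where
      difference : ∀ x y → + toℕ (mul m y) - + toℕ (mul m x) ≈ m * (+ toℕ y - + toℕ x)
      difference x y = ≈-trans (+-cong (toℕ-mul m y) (-‿cong (toℕ-mul m x))) (≈-reflexive (distrib m (+ toℕ y) (+ toℕ x)))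
        where distrib : ∀ m a b → m * a - m * b ≡ m * (a - b)
              distrib = solve-∀
      rescaled : ∀ σ s → m * (sign σ * (+ s * 1ℤ)) ≡ sign σ * (+ s * m)
      rescaled σ s = commute m (sign σ) (+ s)
        where commute : ∀ m g s → m * (g * (s * 1ℤ)) ≡ g * (s * m)
              commute = solve-∀
      rescale : ∀ x y → ScaledCay m S (mul m x) (mul m y) ⇔ ScaledCay 1ℤ S x y
      rescale x y = mk⇔
        (λ { (s , s∈ , σ , e) → s , s∈ , σ , *-cancelˡ prime {m} {+ toℕ y - + toℕ x} {sign σ * (+ s * 1ℤ)} m≉0
               (≈-trans (≈-sym (difference x y)) (≈-trans e (≈-reflexive (≡.sym (rescaled σ s))))) })
        (λ { (s , s∈ , σ , e) → s , s∈ , σ ,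
               ≈-trans (difference x y) (≈-trans (*-congˡ m e) (≈-reflexive (rescaled σ s))) })

module Blocks (p : ℕ) .{{_ : NonZero p}} (prime : Prime p) (5≤p : 5 ℕ.≤ p)
              (d : ℕ) .{{_ : NonZero d}} (2ᵈ∈H : Subgroups.H p prime 5≤p ((+ 2) ℤ.^ d))
              (minimal : ∀ j → j ℕ.< d → Subgroups.H p prime 5≤p ((+ 2) ℤ.^ j) → j ≡ 0)
              (α β : ℕ) (d≡ : d ≡ α ℕ.* 3 ℕ.+ β ℕ.* 4) where

  open import Data.Integer using (_+_; _*_; -_; _-_; _^_)
  open Modulo p
  open Subgroups p prime 5≤p
  open Levels d 2ᵈ∈H minimal
  open Representatives p prime 5≤p d 2ᵈ∈H minimal
  open ScaledCayley p prime

  S : ℕ → List ℕ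
  S w = applyUpTo suc w

  Part : Set
  Part = Fin α ⊎ Fin β

  width : Part → ℕ
  width (inj₁ _) = 3
  width (inj₂ _) = 4

  baseLevel : Part → ℕ
  baseLevel (inj₁ i) = 3 ℕ.* toℕ i
  baseLevel (inj₂ j) = α ℕ.* 3 ℕ.+ 4 ℕ.* toℕ j

  Slot : Set
  Slot = (Fin α × Fin 3) ⊎ (Fin β × Fin 4)

  part : Slot → Part
  part (inj₁ (i , _)) = inj₁ i
  part (inj₂ (j , _)) = inj₂ j

  offset : (sl : Slot) → Fin (width (part sl))
  offset (inj₁ (_ , o)) = o
  offset (inj₂ (_ , o)) = o

  level : Slot → ℕ
  level sl = baseLevel (part sl) ℕ.+ toℕ (offset sl)

  private
    layout : Fin (α ℕ.* 3 ℕ.+ β ℕ.* 4) ↔ Slot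
    layout = ↔-trans Fin.+↔⊎ (Fin.*↔× ⊎-↔ Fin.*↔×)

    toℕ-layout : ∀ sl → toℕ (Inverse.from layout sl) ≡ level sl
    toℕ-layout (inj₁ (i , o)) = ≡.trans (Fin.toℕ-↑ˡ (Fin.combine i o) (β ℕ.* 4)) (Fin.toℕ-combine i o)
    toℕ-layout (inj₂ (j , o)) = ≡.trans (Fin.toℕ-↑ʳ (α ℕ.* 3) (Fin.combine j o))
      (≡.trans (cong (α ℕ.* 3 ℕ.+_) (Fin.toℕ-combine j o)) (≡.sym (ℕ.+-assoc (α ℕ.* 3) (4 ℕ.* toℕ j) (toℕ o))))

  level<d : ∀ sl → level sl ℕ.< d
  level<d sl = ≡.subst₂ ℕ._<_ (toℕ-layout sl) (≡.sym d≡) (Fin.toℕ<n (Inverse.from layout sl))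

  level-injective : ∀ sl sl′ → level sl ≡ level sl′ → sl ≡ sl′
  level-injective sl sl′ eq = begin
    sl                                              ≡⟨ Inverse.strictlyInverseˡ layout sl ⟨
    Inverse.to layout (Inverse.from layout sl)      ≡⟨ cong (Inverse.to layout) (Fin.toℕ-injective same-index) ⟩
    Inverse.to layout (Inverse.from layout sl′)     ≡⟨ Inverse.strictlyInverseˡ layout sl′ ⟩
    sl′                                             ∎
    where
    open ≡.≡-Reasoning
    same-index : toℕ (Inverse.from layout sl) ≡ toℕ (Inverse.from layout sl′)
    same-index = ≡.trans (toℕ-layout sl) (≡.trans eq (≡.sym (toℕ-layout sl′)))

  slot-at : ∀ l → l ℕ.< d → ∃ λ sl → level sl ≡ l
  slot-at l l<d = Inverse.to layout l′ , (begin
    level (Inverse.to layout l′)                       ≡⟨ toℕ-layout (Inverse.to layout l′) ⟨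
    toℕ (Inverse.from layout (Inverse.to layout l′))   ≡⟨ cong toℕ (Inverse.strictlyInverseʳ layout l′) ⟩
    toℕ l′                                             ≡⟨ Fin.toℕ-fromℕ< _ ⟩
    l                                                  ∎)
    where
    open ≡.≡-Reasoning
    l′ : Fin (α ℕ.* 3 ℕ.+ β ℕ.* 4)
    l′ = fromℕ< (≡.subst (l ℕ.<_) d≡ l<d)

  -- s · 2 = unitOf s · 2 ^ shift s with unitOf s ∈ H, so s times the multiplier 2 ^ (Y + 1) · rep k of a run
  -- starting at level Y lies on level Y + shift s.
  shift : ℕ → ℕ
  shift 3 = 0
  shift 4 = 3
  shift s = s

  unitOf : ℕ → ℤ
  unitOf 3 = + 6
  unitOf _ = 1ℤ

  factorAt : ℕ → ℕ
  factorAt 0 = 3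
  factorAt 3 = 4
  factorAt o = o

  S⊆S4 : ∀ r {s} → s ∈ S (width r) → s ∈ S 4
  S⊆S4 (inj₁ _) (here refl)                 = here refl
  S⊆S4 (inj₁ _) (there (here refl))         = there (here refl)
  S⊆S4 (inj₁ _) (there (there (here refl))) = there (there (here refl))
  S⊆S4 (inj₂ _) s∈                          = s∈

  factor-split : ∀ {s} → s ∈ S 4 → + s * + 2 ≡ unitOf s * (+ 2) ^ shift s
  factor-split (here refl)                         = refl
  factor-split (there (here refl))                 = refl
  factor-split (there (there (here refl)))         = refl
  factor-split (there (there (there (here refl)))) = refl

  factorAt-shift : ∀ {s} → s ∈ S 4 → factorAt (shift s) ≡ s
  factorAt-shift (here refl)                         = refl
  factorAt-shift (there (here refl))                 = refl
  factorAt-shift (there (there (here refl)))         = refl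
  factorAt-shift (there (there (there (here refl)))) = refl

  factor≉0 : ∀ {s} → s ∈ S 4 → + s ≉ 0ℤ
  factor≉0 (here refl)                         = 1≉0 prime
  factor≉0 (there (here refl))                 = 2≉0
  factor≉0 (there (there (here refl)))         = 3≉0
  factor≉0 (there (there (there (here refl)))) = 4≉0

  shift<width : ∀ r {s} → s ∈ S (width r) → shift s ℕ.< width r
  shift<width (inj₁ _) (here refl)                         = s≤s (s≤s z≤n)
  shift<width (inj₁ _) (there (here refl))                 = s≤s (s≤s (s≤s z≤n))
  shift<width (inj₁ _) (there (there (here refl)))         = s≤s z≤n
  shift<width (inj₂ _) (here refl)                         = s≤s (s≤s z≤n)
  shift<width (inj₂ _) (there (here refl))                 = s≤s (s≤s (s≤s z≤n))
  shift<width (inj₂ _) (there (there (here refl)))         = s≤s z≤n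
  shift<width (inj₂ _) (there (there (there (here refl)))) = s≤s (s≤s (s≤s (s≤s z≤n)))

  factorAt∈ : ∀ r (o : Fin (width r)) → factorAt (toℕ o) ∈ S (width r)
  factorAt∈ (inj₁ _) Fin.zero                            = there (there (here refl))
  factorAt∈ (inj₁ _) (Fin.suc Fin.zero)                  = here refl
  factorAt∈ (inj₁ _) (Fin.suc (Fin.suc Fin.zero))        = there (here refl)
  factorAt∈ (inj₂ _) Fin.zero                            = there (there (here refl))
  factorAt∈ (inj₂ _) (Fin.suc Fin.zero)                  = here refl
  factorAt∈ (inj₂ _) (Fin.suc (Fin.suc Fin.zero))        = there (here refl)
  factorAt∈ (inj₂ _) (Fin.suc (Fin.suc (Fin.suc Fin.zero))) = there (there (there (here refl)))

  shift-factorAt : ∀ r (o : Fin (width r)) → shift (factorAt (toℕ o)) ≡ toℕ o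
  shift-factorAt (inj₁ _) Fin.zero                            = refl
  shift-factorAt (inj₁ _) (Fin.suc Fin.zero)                  = refl
  shift-factorAt (inj₁ _) (Fin.suc (Fin.suc Fin.zero))        = refl
  shift-factorAt (inj₂ _) Fin.zero                            = refl
  shift-factorAt (inj₂ _) (Fin.suc Fin.zero)                  = refl
  shift-factorAt (inj₂ _) (Fin.suc (Fin.suc Fin.zero))        = refl
  shift-factorAt (inj₂ _) (Fin.suc (Fin.suc (Fin.suc Fin.zero))) = refl

  H-unitOf : ∀ s → H (unitOf s)
  H-unitOf 0 = H-1
  H-unitOf 1 = H-1
  H-unitOf 2 = H-1
  H-unitOf 3 = H-6
  H-unitOf (suc (suc (suc (suc _)))) = H-1

  multiplier : Part → Fin N → ℤ
  multiplier r k = (+ 2) ^ suc (baseLevel r) * + rep k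

  multiple-split : ∀ r k {s} → s ∈ S 4 → + s * multiplier r k ≡ unitOf s * ((+ 2) ^ (baseLevel r ℕ.+ shift s) * + rep k)
  multiple-split r k {s} s∈ = begin
    + s * ((+ 2) ^ suc Y * + rep k)                     ≡⟨ regroup (+ s) ((+ 2) ^ Y) (+ rep k) ⟩
    + s * + 2 * ((+ 2) ^ Y * + rep k)                   ≡⟨ cong (_* ((+ 2) ^ Y * + rep k)) (factor-split s∈) ⟩
    unitOf s * (+ 2) ^ shift s * ((+ 2) ^ Y * + rep k)  ≡⟨ regroup′ (unitOf s) ((+ 2) ^ shift s) ((+ 2) ^ Y) (+ rep k) ⟩
    unitOf s * ((+ 2) ^ Y * (+ 2) ^ shift s * + rep k)  ≡⟨ cong (λ z → unitOf s * (z * + rep k)) (ℤ.^-distribˡ-+-* (+ 2) Y (shift s)) ⟨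
    unitOf s * ((+ 2) ^ (Y ℕ.+ shift s) * + rep k)      ∎
    where
    open ≡.≡-Reasoning
    Y = baseLevel r
    regroup : ∀ s a e → s * (+ 2 * a * e) ≡ s * + 2 * (a * e)
    regroup = solve-∀
    regroup′ : ∀ u b a e → u * b * (a * e) ≡ u * (a * b * e)
    regroup′ = solve-∀

  multiplier≉0 : ∀ r k → multiplier r k ≉ 0ℤ
  multiplier≉0 r k = *-≉0 prime {(+ 2) ^ suc (baseLevel r)} {+ rep k} (^-≉0 prime {+ 2} (suc (baseLevel r)) 2≉0) (rep≉0 k)

  Block : Set
  Block = Part × Fin N

  blockGraph : Block → Graph p
  blockGraph (r , k) = ScaledCay (multiplier r k) (S (width r))

  blockGraph≅Cay : ∀ b → blockGraph b ≅ Cay p (S (width (proj₁ b)))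
  blockGraph≅Cay (r , k) = scale-iso (multiplier≉0 r k) (S (width r))

  slotOf : ∀ r {s} → s ∈ S (width r) → Slot
  slotOf (inj₁ i) s∈ = inj₁ (i , fromℕ< (shift<width (inj₁ i) s∈))
  slotOf (inj₂ j) s∈ = inj₂ (j , fromℕ< (shift<width (inj₂ j) s∈))

  part-slotOf : ∀ r {s} (s∈ : s ∈ S (width r)) → part (slotOf r s∈) ≡ r
  part-slotOf (inj₁ _) _ = refl
  part-slotOf (inj₂ _) _ = refl

  offset-slotOf : ∀ r {s} (s∈ : s ∈ S (width r)) → toℕ (offset (slotOf r s∈)) ≡ shift s
  offset-slotOf (inj₁ i) s∈ = Fin.toℕ-fromℕ< (shift<width (inj₁ i) s∈)
  offset-slotOf (inj₂ j) s∈ = Fin.toℕ-fromℕ< (shift<width (inj₂ j) s∈)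

  level-slotOf : ∀ r {s} (s∈ : s ∈ S (width r)) → level (slotOf r s∈) ≡ baseLevel r ℕ.+ shift s
  level-slotOf (inj₁ i) s∈ = cong (baseLevel (inj₁ i) ℕ.+_) (offset-slotOf (inj₁ i) s∈)
  level-slotOf (inj₂ j) s∈ = cong (baseLevel (inj₂ j) ℕ.+_) (offset-slotOf (inj₂ j) s∈)

  levelCode : Slot → Fin d
  levelCode sl = fromℕ< (level<d sl)

  LevelCoded : ∀ r k {s} → s ∈ S (width r) → ℤ → Set
  LevelCoded r k {s} s∈ D =
    ∃₂ λ υ j → ∃ λ τ → D ≈ ⟦ υ , levelCode (slotOf r s∈) , j ⟧ × unitOf s * + rep k ≈ sign τ * + rep j

  edge-code : ∀ r k {s} (s∈ : s ∈ S (width r)) σ → LevelCoded r k s∈ (sign σ * (+ s * multiplier r k))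
  edge-code r k {s} s∈ σ = build (Base⇒±rep (Base-H (H-unitOf s) ≈-refl (Base-rep k))
                                   (*-≉0 prime {unitOf s} {+ rep k} (H-≉0 (H-unitOf s)) (rep≉0 k)))
    where
    L = baseLevel r ℕ.+ shift s
    build : (∃₂ λ τ j → unitOf s * + rep k ≈ sign τ * + rep j) → LevelCoded r k s∈ (sign σ * (+ s * multiplier r k))
    build (τ , j , uE≈) = combine (sign-* σ τ)
      where
      combine : (∃ λ υ → sign σ * sign τ ≡ sign υ) → LevelCoded r k s∈ (sign σ * (+ s * multiplier r k))
      combine (υ , στ≡υ) = υ , j , τ , (begin
        sign σ * (+ s * multiplier r k)                          ≡⟨ cong (sign σ *_) (multiple-split r k (S⊆S4 r s∈)) ⟩
        sign σ * (unitOf s * ((+ 2) ^ L * + rep k))              ≡⟨ cong (sign σ *_) (swap (unitOf s) ((+ 2) ^ L) (+ rep k)) ⟩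
        sign σ * ((+ 2) ^ L * (unitOf s * + rep k))              ≈⟨ *-congˡ (sign σ) (*-congˡ ((+ 2) ^ L) uE≈) ⟩
        sign σ * ((+ 2) ^ L * (sign τ * + rep j))                ≡⟨ regroup (sign σ) ((+ 2) ^ L) (sign τ) (+ rep j) ⟩
        sign σ * sign τ * ((+ 2) ^ L * + rep j)                  ≡⟨ cong (_* ((+ 2) ^ L * + rep j)) στ≡υ ⟩
        sign υ * ((+ 2) ^ L * + rep j)                           ≡⟨ cong (λ n → sign υ * ((+ 2) ^ n * + rep j)) L≡ ⟩
        ⟦ υ , levelCode (slotOf r s∈) , j ⟧                      ∎) , uE≈
        where
        open ≈-Reasoning
        L≡ : L ≡ toℕ (levelCode (slotOf r s∈))
        L≡ = ≡.sym (≡.trans (Fin.toℕ-fromℕ< (level<d (slotOf r s∈))) (level-slotOf r s∈))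
        swap : ∀ u a e → u * (a * e) ≡ a * (u * e)
        swap = solve-∀
        regroup : ∀ g a t e → g * (a * (t * e)) ≡ g * t * (a * e)
        regroup = solve-∀

  unit-rep-preimage : ∀ s j → ∃₂ λ τ k → + rep j ≈ sign τ * (unitOf s * + rep k)
  unit-rep-preimage s j = preimage (H-inverse (H-unitOf s))
    where
    preimage : (∃ λ u′ → H u′ × unitOf s * u′ ≈ 1ℤ) → ∃₂ λ τ k → + rep j ≈ sign τ * (unitOf s * + rep k)
    preimage (u′ , hu′ , uu′≈1) = lift (Base⇒±rep (Base-H hu′ ≈-refl (Base-rep j))
                                                   (*-≉0 prime {u′} {+ rep j} (H-≉0 hu′) (rep≉0 j)))
      where
      lift : (∃₂ λ τ k → u′ * + rep j ≈ sign τ * + rep k) → ∃₂ λ τ k → + rep j ≈ sign τ * (unitOf s * + rep k)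
      lift (τ , k , z≈) = τ , k , (begin
        + rep j                               ≈⟨ inverse-cancelˡ u′ (unitOf s) (+ rep j) (≈-trans (≈-reflexive (ℤ.*-comm u′ (unitOf s))) uu′≈1) ⟨
        unitOf s * (u′ * + rep j)             ≈⟨ *-congˡ (unitOf s) z≈ ⟩
        unitOf s * (sign τ * + rep k)         ≡⟨ swap (unitOf s) (sign τ) (+ rep k) ⟩
        sign τ * (unitOf s * + rep k)         ∎)
        where
        open ≈-Reasoning
        swap : ∀ u g e → u * (g * e) ≡ g * (u * e)
        swap = solve-∀

  unit-rep-injective : ∀ s k k′ τ τ′ j → unitOf s * + rep k ≈ sign τ * + rep j → unitOf s * + rep k′ ≈ sign τ′ * + rep j → k ≡ k′
  unit-rep-injective s k k′ τ τ′ j uE≈ uE′≈ = proj₂ (±rep-injective τ τ′ k k′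
    (*-cancelˡ prime {unitOf s} {sign τ * + rep k} {sign τ′ * + rep k′} (H-≉0 (H-unitOf s)) (begin
      unitOf s * (sign τ * + rep k)       ≡⟨ swap (unitOf s) (sign τ) (+ rep k) ⟩
      sign τ * (unitOf s * + rep k)       ≈⟨ sign-move τ (unitOf s * + rep k) (+ rep j) uE≈ ⟩
      + rep j                             ≈⟨ sign-move τ′ (unitOf s * + rep k′) (+ rep j) uE′≈ ⟨
      sign τ′ * (unitOf s * + rep k′)     ≡⟨ swap (unitOf s) (sign τ′) (+ rep k′) ⟨
      unitOf s * (sign τ′ * + rep k′)     ∎)))
    where
    open ≈-Reasoning
    swap : ∀ u g e → u * (g * e) ≡ g * (u * e)
    swap = solve-∀

  Edge : Block → ℤ → Set
  Edge (r , k) D = ∃ λ s → s ∈ S (width r) × ∃ λ υ → D ≈ sign υ * (+ s * multiplier r k)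

  edge-exists : ∀ {D} → D ≉ 0ℤ → ∃ λ b → Edge b D
  edge-exists {D} D≉0 = fromCode (decode D≉0)
    where
    fromCode : (∃ λ c → D ≈ ⟦ c ⟧) → ∃ λ b → Edge b D
    fromCode ((σ , l , j) , D≈) = fromSlot (slot-at (toℕ l) (Fin.toℕ<n l))
      where
      fromSlot : (∃ λ sl → level sl ≡ toℕ l) → ∃ λ b → Edge b D
      fromSlot (sl , level≡l) = fromPreimage (unit-rep-preimage s j)
        where
        r = part sl
        s = factorAt (toℕ (offset sl))
        l≡ : toℕ l ≡ baseLevel r ℕ.+ shift s
        l≡ = ≡.trans (≡.sym level≡l) (cong (baseLevel r ℕ.+_) (≡.sym (shift-factorAt r (offset sl))))
        fromPreimage : (∃₂ λ τ k → + rep j ≈ sign τ * (unitOf s * + rep k)) → ∃ λ b → Edge b D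
        fromPreimage (τ , k , Ej≈) = combine (sign-* σ τ)
          where
          combine : (∃ λ υ → sign σ * sign τ ≡ sign υ) → ∃ λ b → Edge b D
          combine (υ , στ≡υ) = (r , k) , s , factorAt∈ r (offset sl) , υ , (begin
            D                                                            ≈⟨ D≈ ⟩
            sign σ * ((+ 2) ^ toℕ l * + rep j)                           ≈⟨ *-congˡ (sign σ) (*-congˡ ((+ 2) ^ toℕ l) Ej≈) ⟩
            sign σ * ((+ 2) ^ toℕ l * (sign τ * (unitOf s * + rep k)))   ≡⟨ regroup (sign σ) ((+ 2) ^ toℕ l) (sign τ) (unitOf s) (+ rep k) ⟩
            sign σ * sign τ * (unitOf s * ((+ 2) ^ toℕ l * + rep k))     ≡⟨ cong₂ (λ g n → g * (unitOf s * ((+ 2) ^ n * + rep k))) στ≡υ l≡ ⟩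
            sign υ * (unitOf s * ((+ 2) ^ (baseLevel r ℕ.+ shift s) * + rep k))
              ≡⟨ cong (sign υ *_) (multiple-split r k (S⊆S4 r (factorAt∈ r (offset sl)))) ⟨
            sign υ * (+ s * multiplier r k)                              ∎)
            where
            open ≈-Reasoning
            regroup : ∀ g a t u e → g * (a * (t * (u * e))) ≡ g * t * (u * (a * e))
            regroup = solve-∀

  edge-unique : ∀ {D} b b′ → Edge b D → Edge b′ D → b ≡ b′
  edge-unique {D} (r , k) (r′ , k′) (s , s∈ , σ , D≈) (s′ , s′∈ , σ′ , D≈′) =
    compare (edge-code r k s∈ σ) (edge-code r′ k′ s′∈ σ′)
    where
    compare : LevelCoded r k s∈ (sign σ * (+ s * multiplier r k)) → LevelCoded r′ k′ s′∈ (sign σ′ * (+ s′ * multiplier r′ k′)) →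
              (r , k) ≡ (r′ , k′)
    compare (υ , j , τ , code≈ , uE≈) (υ′ , j′ , τ′ , code≈′ , uE′≈) = ≡.cong₂ _,_ r≡r′ k≡k′
      where
      codes : (υ , levelCode (slotOf r s∈) , j) ≡ (υ′ , levelCode (slotOf r′ s′∈) , j′)
      codes = ⟦⟧-injective _ _ (≈-trans (≈-sym (≈-trans D≈ code≈)) (≈-trans D≈′ code≈′))
      slots : slotOf r s∈ ≡ slotOf r′ s′∈
      slots = level-injective _ _ (≡.trans (≡.sym (Fin.toℕ-fromℕ< (level<d (slotOf r s∈))))
                (≡.trans (cong (λ c → toℕ (proj₁ (proj₂ c))) codes) (Fin.toℕ-fromℕ< (level<d (slotOf r′ s′∈)))))
      r≡r′ : r ≡ r′
      r≡r′ = ≡.trans (≡.sym (part-slotOf r s∈)) (≡.trans (cong part slots) (part-slotOf r′ s′∈))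
      s≡s′ : s ≡ s′
      s≡s′ = ≡.trans (≡.sym (factorAt-shift (S⊆S4 r s∈))) (≡.trans (cong factorAt shift≡)
               (factorAt-shift (S⊆S4 r′ s′∈)))
        where
        shift≡ : shift s ≡ shift s′
        shift≡ = ≡.trans (≡.sym (offset-slotOf r s∈)) (≡.trans (cong (λ sl → toℕ (offset sl)) slots) (offset-slotOf r′ s′∈))
      k≡k′ : k ≡ k′
      k≡k′ = unit-rep-injective s k k′ τ τ′ j uE≈ (≡.subst₂ (λ t i → unitOf t * + rep k′ ≈ sign τ′ * + rep i) (≡.sym s≡s′)
               (≡.sym (cong (λ c → proj₂ (proj₂ c)) codes)) uE′≈)

  blocks-factorise : IsFactorisationOfK p blockGraph
  blocks-factorise = loopless , covering , disjoint
    where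
    difference≉0 : ∀ {x y : Fin p} → ¬ x ≡ y → + toℕ y - + toℕ x ≉ 0ℤ
    difference≉0 {x} {y} x≢y y-x≈0 =
      x≢y (Fin.toℕ-injective (≈-small-injective (Fin.toℕ<n x) (Fin.toℕ<n y) (≈-sym (-≈0⇒≈ y-x≈0))))
    loopless : ∀ b x y → blockGraph b x y → ¬ x ≡ y
    loopless (r , k) x .x (s , s∈ , σ , x-x≈) refl =
      *-≉0 prime {sign σ} {+ s * multiplier r k} (sign≉0 prime σ)
        (*-≉0 prime {+ s} {multiplier r k} (factor≉0 (S⊆S4 r s∈)) (multiplier≉0 r k))
        (≈-trans (≈-sym x-x≈) (≈-reflexive (ℤ.+-inverseʳ (+ toℕ x))))
    covering : ∀ x y → ¬ x ≡ y → ∃ λ b → blockGraph b x y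
    covering x y x≢y = edge-exists (difference≉0 x≢y)
    disjoint : ∀ x y b b′ → blockGraph b x y → blockGraph b′ x y → b ≡ b′
    disjoint x y = edge-unique


IsFactorisation-reindex : ∀ {p} {I J : Set} {F : I → Graph p} {G : J → Graph p} (e : I ↔ J) →
                          (∀ i → F i ≡ G (Inverse.to e i)) → IsFactorisationOfK p G → IsFactorisationOfK p F
IsFactorisation-reindex {F = F} {G} e F≡G (loopless , covering , disjoint) = loopless′ , covering′ , disjoint′
  where
  F⇒G : ∀ i {x y} → F i x y → G (Inverse.to e i) x y
  F⇒G i {x} {y} = ≡.subst (λ H → H x y) (F≡G i)
  loopless′ : ∀ i x y → F i x y → ¬ x ≡ y
  loopless′ i x y edge = loopless (Inverse.to e i) x y (F⇒G i edge)
  covering′ : ∀ x y → ¬ x ≡ y → ∃ λ i → F i x y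
  covering′ x y x≢y with covering x y x≢y
  ... | j , edge = Inverse.from e j ,
    ≡.subst (λ H → H x y) (≡.sym (F≡G (Inverse.from e j)))
      (≡.subst (λ j′ → G j′ x y) (≡.sym (Inverse.strictlyInverseˡ e j)) edge)
  disjoint′ : ∀ x y i i′ → F i x y → F i′ x y → i ≡ i′
  disjoint′ x y i i′ edge edge′ = begin
    i                                  ≡⟨ Inverse.strictlyInverseʳ e i ⟨
    Inverse.from e (Inverse.to e i)    ≡⟨ cong (Inverse.from e) (disjoint x y _ _ (F⇒G i edge) (F⇒G i′ edge′)) ⟩
    Inverse.from e (Inverse.to e i′)   ≡⟨ Inverse.strictlyInverseʳ e i′ ⟩
    i′                                 ∎
    where open ≡.≡-Reasoning

module Factorisation (p : ℕ) .{{_ : NonZero p}} (prime : Prime p) (5≤p : 5 ℕ.≤ p)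
                     (d : ℕ) .{{_ : NonZero d}} (2ᵈ∈H : Subgroups.H p prime 5≤p ((+ 2) ℤ.^ d))
                     (minimal : ∀ j → j ℕ.< d → Subgroups.H p prime 5≤p ((+ 2) ℤ.^ j) → j ≡ 0)
                     (α β : ℕ) (d≡ : d ≡ α ℕ.* 3 ℕ.+ β ℕ.* 4) where

  open Representatives p prime 5≤p d 2ᵈ∈H minimal using (N; p∸1≡2dN)
  open Blocks p prime 5≤p d 2ᵈ∈H minimal α β d≡

  a b : ℕ
  a = α ℕ.* N
  b = β ℕ.* N

  F : Fin a → Graph p
  F i = blockGraph (map₁ inj₁ (Inverse.to (Fin.*↔× {α} {N}) i))

  G : Fin b → Graph p
  G j = blockGraph (map₁ inj₂ (Inverse.to (Fin.*↔× {β} {N}) j))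

  factorisation : IsFactorisationOfK p [ F , G ]F
  factorisation = IsFactorisation-reindex indexing (λ { (inj₁ _) → refl ; (inj₂ _) → refl }) blocks-factorise
    where
    indexing : (Fin a ⊎ Fin b) ↔ Block
    indexing = ↔-trans (Fin.*↔× {α} {N} ⊎-↔ Fin.*↔× {β} {N}) (↔-sym (×-distribʳ-⊎ 0ℓ (Fin N) (Fin α) (Fin β)))

  F≅Cay : ∀ i → F i ≅ Cay p (1 ∷ 2 ∷ 3 ∷ [])
  F≅Cay i = blockGraph≅Cay (map₁ inj₁ (Inverse.to (Fin.*↔× {α} {N}) i))

  G≅Cay : ∀ j → G j ≅ Cay p (1 ∷ 2 ∷ 3 ∷ 4 ∷ [])
  G≅Cay j = blockGraph≅Cay (map₁ inj₂ (Inverse.to (Fin.*↔× {β} {N}) j))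

  copies : ∀ γ → γ ℕ.* N ℕ.* (2 ℕ.* d) ≡ γ ℕ.* (p ℕ.∸ 1)
  copies γ = ≡.trans (regroup γ N d) (cong (γ ℕ.*_) (≡.sym p∸1≡2dN))
    where regroup : ∀ γ N d → γ ℕ.* N ℕ.* (2 ℕ.* d) ≡ γ ℕ.* (2 ℕ.* (d ℕ.* N))
          regroup = ℕSolver.solve-∀

module ResidueSubgroup (p : ℕ) .{{_ : NonZero p}} (prime : Prime p) (5≤p : 5 ℕ.≤ p) where

  open import Data.Integer using (_+_; _*_; -_; _-_; _^_)
  open Modulo p
  open Subgroups p prime 5≤p

  pos-^ : ∀ a n → + (a ℕ.^ n) ≡ (+ a) ^ n
  pos-^ a zero    = refl
  pos-^ a (suc n) = ≡.trans (ℤ.pos-* a (a ℕ.^ n)) (cong (+ a ℤ.*_) (pos-^ a n))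

  signPow≈ : ∀ e → + signPow p e ≈ -1ℤ ^ e
  signPow≈ zero    = ≈-refl
  signPow≈ (suc e) = ≈-trans (≈-reflexive (ℤ.pos-* (p ℕ.∸ 1) (signPow p e))) (*-cong p∸1≈-1 (signPow≈ e))
    where
    p∸1≈-1 : + (p ℕ.∸ 1) ≈ -1ℤ
    p∸1≈-1 = ≈-trans (≈-reflexive (≡.sym (≡.trans (ℤ.m-n≡m⊖n p 1) (ℤ.⊖-≥ (ℕ.>-nonZero⁻¹ p)))))
               (+-cong p≈0 (≈-refl { -1ℤ}))

  word≈ : ∀ e k → + (signPow p e ℕ.* 6 ℕ.^ k) ≈ hword e k
  word≈ e k = ≈-trans (≈-reflexive (ℤ.pos-* (signPow p e) (6 ℕ.^ k)))
                (*-cong (signPow≈ e) (≈-reflexive (pos-^ 6 k)))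

  InH⇒H : ∀ n → InH p n → H (+ n)
  InH⇒H n (e , k , same) = e , k , ≈-trans (residue-injective {+ n} {+ (signPow p e ℕ.* 6 ℕ.^ k)} same) (word≈ e k)

  H⇒InH : ∀ n → H (+ n) → InH p n
  H⇒InH n (e , k , n≈) = e , k , residue-cong {+ n} {+ (signPow p e ℕ.* 6 ℕ.^ k)} (≈-trans n≈ (≈-sym (word≈ e k)))

  order-of-2H : ∀ {d} → IsOrderOf2H p d → H ((+ 2) ^ d) × (∀ j → j ℕ.< d → H ((+ 2) ^ j) → j ≡ 0)
  order-of-2H {d} (_ , 2ᵈ∈H , 2ʲ∉H) = H-cong (≈-reflexive (pos-^ 2 d)) (InH⇒H (2 ℕ.^ d) 2ᵈ∈H) , minimal
    where
    minimal : ∀ j → j ℕ.< d → H ((+ 2) ^ j) → j ≡ 0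
    minimal zero    _   _    = refl
    minimal (suc j) j<d 2ʲ∈H = contradiction (H⇒InH (2 ℕ.^ suc j) (H-cong (≈-reflexive (≡.sym (pos-^ 2 (suc j)))) 2ʲ∈H))
                                             (2ʲ∉H (suc j) (s≤s z≤n) j<d)

open import Data.Nat using (_+_; _*_; _∸_; _≤_)

lemma6 : (p : ℕ) → Prime p → .{{_ : NonZero p}} → 5 ≤ p → (d : ℕ) →
    IsOrderOf2H p d →
    (α β : ℕ) → d ≡ 3 * α + 4 * β →
    ∃ λ a → ∃ λ b → (a * (2 * d) ≡ α * (p ∸ 1)) × (b * (2 * d) ≡ β * (p ∸ 1)) ×
      ∃ λ (F : Fin a → Graph p) → ∃ λ (G : Fin b → Graph p) →
        IsFactorisationOfK p [ F , G ]F ×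
        (∀ i → F i ≅ Cay p (1 ∷ 2 ∷ 3 ∷ [])) ×
        (∀ j → G j ≅ Cay p (1 ∷ 2 ∷ 3 ∷ 4 ∷ []))
lemma6 p p-prime 5≤p d order α β d≡ = a , b , copies α , copies β , F , G , factorisation , F≅Cay , G≅Cay
  where
  instance
    d≢0 : NonZero d
    d≢0 = ℕ.>-nonZero (proj₁ order)
  open ResidueSubgroup p p-prime 5≤p using (order-of-2H)
  open Factorisation p p-prime 5≤p d (proj₁ (order-of-2H order)) (proj₂ (order-of-2H order)) α β
         (≡.trans d≡ (cong₂ _+_ (ℕ.*-comm 3 α) (ℕ.*-comm 4 β)))
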